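{- Suppose all $a_0,\ldots,a_{n-1}$ are positive. Then a vertex $v$ of $\Pi$ is non-relevant if and only if there exists $l\in\mathbb Z$ with $v_l=0$ and $v_{l+n-1}\ne0$.
   Context: Fix $n\ge2$, positive integers $a_0,\ldots,a_{n-1}$ (indices mod $n$), $k=\sum a_i$. $V$: real two-sided sequences $x$ with $x_i=0$ for $i\gg0$, $x_i=a_{i\bmod n}$ for $i\ll0$; $\Pi=\{x\in V:x_i\ge0,\ x_{i-n+1}+\cdots+x_i\le k\ \forall i\}$; faces are nonempty intersections of $\Pi$ with some sets $\{x_i=0\}$, $\{x_{i-n+1}+\cdots+x_i=k\}$; vertices are minimal faces. $s_{i,j}(x)=\sum_{l\le in+j(n-1)}(x_l-T^{i+j}_l)-\sum_{l=in+j(n-1)+1}^{(i+j)n}T^{i+j}_l$ with $T^m_l=a_{l\bmod n}$ for $l\le mn$, $0$ otherwise. $\Theta_v$: graph on $\mathbb Z^2$ joining $(i,j)$ with $(i-1,j)$ (resp. $(i-1,j+1)$) iff $s_{i,j}(v)=s_{i-1,j}(v)$ (resp. $s_{i-1,j+1}(v)$); row $i$ is $\{(i,j):j\in\mathbb Z\}$. A vertex $v$ is non-relevant if some connected component of $\Theta_v$ has more vertices in row $i+1$ than in row $i$ for some integer $i$, and relevant otherwise.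
   Formalization: The sequences in $V$ take rational rather than real values, so $\Pi$, its faces and its vertices are taken over ℚ. -}

module Defs where

open import Level using (0ℓ)
open import Data.Bool using (if_then_else_)
open import Data.Nat as ℕ using (ℕ; zero; suc; NonZero)
open import Data.Fin using (Fin; fromℕ<)
open import Data.List using (map; allFin)
open import Data.Nat.ListAction using (sum)
open import Data.Integer as ℤ using (ℤ; +_; -[1+_]; _%ℕ_)
open import Data.Integer.DivMod using (n%ℕd<d)
open import Data.Rational as ℚ using (ℚ; 0ℚ)
open import Data.Product using (Σ; ∃; _×_; _,_; proj₁; proj₂)
open import Data.Sum using (_⊎_)
open import Relation.Nullary using (¬_)
open import Relation.Nullary.Decidable using (⌊_⌋)
open import Relation.Binary.PropositionalEquality using (_≡_)
open import Relation.Binary.Construct.Closure.ReflexiveTransitive using (Star)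

sumCount : ℤ → ℕ → (ℤ → ℚ) → ℚ
sumCount L zero    f = 0ℚ
sumCount L (suc c) f = f L ℚ.+ sumCount (L ℤ.+ + 1) c f

clamp : ℤ → ℕ
clamp (+ m)    = m
clamp -[1+ _ ] = 0

sumFromTo : ℤ → ℤ → (ℤ → ℚ) → ℚ
sumFromTo L U f = sumCount L (clamp (U ℤ.- L ℤ.+ + 1)) f

fromℕℚ : ℕ → ℚ
fromℕℚ m = (+ m) ℚ./ 1

-- Everything below is relative to fixed n (n ≠ 0) and a : Fin n → ℕ,
-- with a_i read as a (i mod n) for i ∈ ℤ.
module Setup (n : ℕ) {{nz : NonZero n}} (a : Fin n → ℕ) where

  aℤ : ℤ → ℚ
  aℤ l = fromℕℚ (a (fromℕ< (n%ℕd<d l n)))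

  k : ℕ
  k = sum (map a (allFin n))

  -- The space V: two-sided sequences x with x_i = 0 for i ≫ 0 and
  -- x_i = a_{i mod n} for i ≪ 0; N is a witness of where the tails start.
  record V : Set where
    field
      x     : ℤ → ℚ
      N     : ℕ
      right : ∀ i → + N ℤ.< i → x i ≡ 0ℚ
      left  : ∀ i → i ℤ.< ℤ.- (+ N) → x i ≡ aℤ i
  open V public

  _≈_ : V → V → Set
  u ≈ w = ∀ i → x u i ≡ x w i

  window : V → ℤ → ℚ
  window u i = sumFromTo (i ℤ.- + n ℤ.+ + 1) i (x u)

  InΠ : V → Set
  InΠ u = (∀ i → 0ℚ ℚ.≤ x u i) × (∀ i → window u i ℚ.≤ fromℕℚ k)

  InF : (A B : ℤ → Set) → V → Set
  InF A B u = InΠ u × (∀ i → A i → x u i ≡ 0ℚ)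
                    × (∀ i → B i → window u i ≡ fromℕℚ k)

  IsFace : (A B : ℤ → Set) → Set
  IsFace A B = ∃ λ u → InF A B u

  IsMinimalFace : (A B : ℤ → Set) → Set₁
  IsMinimalFace A B =
    IsFace A B ×
    (∀ (A′ B′ : ℤ → Set) → IsFace A′ B′ →
       (∀ u → InF A′ B′ u → InF A B u) →
       (∀ u → InF A B u → InF A′ B′ u))

  IsVertex : V → Set₁
  IsVertex v = Σ (ℤ → Set) λ A → Σ (ℤ → Set) λ B →
    IsMinimalFace A B × InF A B v × (∀ u → InF A B u → u ≈ v)

  T : ℤ → ℤ → ℚ
  T m l = if ⌊ l ℤ.≤? m ℤ.* + n ⌋ then aℤ l else 0ℚ

  -- s_{i,j}(x) = Σ_{l ≤ in+j(n-1)} (x_l - T^{i+j}_l)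
  --              - Σ_{l = in+j(n-1)+1}^{(i+j)n} T^{i+j}_l.
  -- The first (formally infinite) sum is truncated below at
  -- L = min(-N-1, (i+j)n); all its terms with l ≤ L vanish.
  s : ℤ → ℤ → V → ℚ
  s i j u =
    sumFromTo L U (λ l → x u l ℚ.- T m l) ℚ.- sumFromTo (U ℤ.+ + 1) (m ℤ.* + n) (T m)
    where
      m = i ℤ.+ j
      U = i ℤ.* + n ℤ.+ j ℤ.* (+ n ℤ.- + 1)
      L = (ℤ.- (+ N u) ℤ.- + 1) ℤ.⊓ (m ℤ.* + n)

  Edge : V → ℤ × ℤ → ℤ × ℤ → Set
  Edge v (i , j) q =
      (q ≡ (i ℤ.- + 1 , j) × s i j v ≡ s (i ℤ.- + 1) j v)
    ⊎ (q ≡ (i ℤ.- + 1 , j ℤ.+ + 1) × s i j v ≡ s (i ℤ.- + 1) (j ℤ.+ + 1) v)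

  Adj : V → ℤ × ℤ → ℤ × ℤ → Set
  Adj v p q = Edge v p q ⊎ Edge v q p

  Connected : V → ℤ × ℤ → ℤ × ℤ → Set
  Connected v = Star (Adj v)

  RowPart : V → ℤ × ℤ → ℤ → ℤ → Set
  RowPart v p i j = Connected v p (i , j)

  Injects : (P Q : ℤ → Set) → Set
  Injects P Q = Σ (Σ ℤ P → Σ ℤ Q) λ f →
    ∀ u w → proj₁ (f u) ≡ proj₁ (f w) → proj₁ u ≡ proj₁ w

  StrictlyFewer : (P Q : ℤ → Set) → Set
  StrictlyFewer P Q = Injects P Q × ¬ Injects Q P

  NonRelevant : V → Set
  NonRelevant v = ∃ λ (p : ℤ × ℤ) → ∃ λ (i : ℤ) →
    StrictlyFewer (RowPart v p i) (RowPart v p (i ℤ.+ + 1))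

module Submission where

-- Write P for the prefix sums of v.  Up to a term depending only on i + j,
-- s_{i,j}(v) = P (in + j(n-1)), so Θ_v has an edge from (i, j) down to
-- (i-1, j+1) when v vanishes at in + j(n-1), and one down to (i-1, j) when the
-- window ending there is tight (sums to k); along a row s never increases, and
-- it drops strictly unless the n-1 entries after in + j(n-1) sum to k.
--
-- Every nonzero entry of a vertex v ends a tight window: otherwise, raising P
-- by a small ε at every position not pinned down by the tail of v and the
-- constraints tight at v gives a second point of the face of v.  Hence, if no l has
-- v_l = 0 ≠ v_{l+n-1}, moving (i+1, j) to (i, j+1) or to (i, j), according as v
-- vanishes at (i+1)n + j(n-1) or not, injects row i+1 of every component of
-- Θ_v into row i.  Conversely such an l can be pushed left until the n-1
-- entries before it sum to less than k; then the component of (l-1, 1-l) meets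
-- row l-1 only there, but row l at both (l, -l) and (l, 1-l).

open import Defs
open import Data.Nat using (ℕ; _≤_; _<_; NonZero)
open import Data.Fin using (Fin)
open import Data.Integer using (ℤ; +_; _+_; _-_)
open import Data.Rational using (0ℚ)
open import Data.Product using (∃; _×_; _,_)
open import Function.Bundles using (_⇔_; mk⇔)
open import Relation.Binary.PropositionalEquality using (_≡_; _≢_)

import Algebra.Properties.Group as GroupProperties
open import Data.Bool using (if_then_else_)
open import Data.Empty using (⊥-elim)
open import Data.Fin as Fin using (toℕ)
import Data.Fin.Properties as FinP
open import Data.Integer as ℤ using (-[1+_]; -_; ∣_∣)
open import Data.Integer.DivMod using (n%ℕd<d; a≡a%ℕn+[a/ℕn]*n)
import Data.Integer.Properties as ℤP
open import Data.Integer.Tactic.RingSolver using (solve-∀)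
open import Data.List using (tabulate)
import Data.List.Properties as ListP
open import Data.Nat as ℕ using (zero; suc)
import Data.Nat.Coprimality as Coprimality
open import Data.Nat.DivMod using (m<n⇒m%n≡m)
open import Data.Nat.ListAction using (sum)
import Data.Nat.Properties as ℕP
open import Data.Product using (Σ; proj₁; proj₂)
open import Data.Rational as ℚ using (ℚ; mkℚ)
import Data.Rational.Properties as ℚP
open import Data.Rational.Solver using (module +-*-Solver)
open import Data.Sum using (_⊎_; inj₁; inj₂)
open import Function using (_∘_)
open import Relation.Binary.Construct.Closure.ReflexiveTransitive using (_◅_; _◅◅_) renaming (ε to ε★)
open import Relation.Binary.Definitions using (Tri; tri<; tri≈; tri>)
open import Relation.Binary.PropositionalEquality
  using (refl; sym; trans; cong; cong₂; subst; subst₂; module ≡-Reasoning)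
open import Relation.Nullary using (¬_; ¬?; Dec; yes; no)
open import Relation.Nullary.Decidable
  using (decidable-stable; map′; _×-dec_; _⊎-dec_; does; dec-true; dec-false; does-≡)

open +-*-Solver using (solve; _:=_; _:+_; _:-_; :-_)

≤-offset : ∀ {i j} → i ℤ.≤ j → ∃ λ m → j ≡ i + + m
≤-offset {i} {j} i≤j = ∣ j - i ∣ , (begin
  j                ≡⟨ split i j ⟩
  i + (j - i)      ≡⟨ cong (λ d → i + d) (sym (ℤP.0≤i⇒+∣i∣≡i (ℤP.i≤j⇒0≤j-i i≤j))) ⟩
  i + + ∣ j - i ∣  ∎)
  where
  open ≡-Reasoning
  split : ∀ i j → j ≡ i + (j - i)
  split = solve-∀

<-offset : ∀ {i j} → i ℤ.< j → ∃ λ m → j ≡ i + + suc m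
<-offset {i} {j} i<j with ≤-offset (ℤP.i<j⇒suc[i]≤j i<j)
... | m , refl = m , trans (ring i (+ m)) (cong (λ d → i + d) (sym (ℤP.pos-+ 1 m)))
  where
  ring : ∀ i m → + 1 + i + m ≡ i + (+ 1 + m)
  ring = solve-∀

offset-within : ∀ {lo i hi} → lo ℤ.≤ i → i ℤ.≤ hi → ∃ λ m → m ℕ.≤ ∣ hi - lo ∣ × i ≡ lo + + m
offset-within {lo} {i} {hi} lo≤i i≤hi with ≤-offset lo≤i
... | m , refl = m , ℤP.drop‿+≤+ (subst (+ m ℤ.≤_) (sym +∣hi-lo∣≡hi-lo) m≤hi-lo) , refl
  where
  ring : ∀ lo m → m ≡ lo + m - lo
  ring = solve-∀
  m≤hi-lo : + m ℤ.≤ hi - lo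
  m≤hi-lo = subst (ℤ._≤ hi - lo) (sym (ring lo (+ m))) (ℤP.+-monoˡ-≤ (- lo) i≤hi)
  +∣hi-lo∣≡hi-lo : + ∣ hi - lo ∣ ≡ hi - lo
  +∣hi-lo∣≡hi-lo = ℤP.0≤i⇒+∣i∣≡i (ℤP.≤-trans (ℤ.+≤+ ℕ.z≤n) m≤hi-lo)

+-cancelʳ-≡ : ∀ {i j} k → i + k ≡ j + k → i ≡ j
+-cancelʳ-≡ {i} {j} k e = trans (ring i k) (trans (cong (λ l → l - k) e) (sym (ring j k)))
  where
  ring : ∀ i k → i ≡ i + k - k
  ring = solve-∀

i-1<i : ∀ i → i - + 1 ℤ.< i
i-1<i i = ℤP.<-≤-trans (ℤP.+-monoʳ-< i (ℤ.-<+ {n = 0})) (ℤP.≤-reflexive (ℤP.+-identityʳ i))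

i+m<i+[1+m] : ∀ i m → i + + m ℤ.< i + + suc m
i+m<i+[1+m] i m = ℤP.+-monoʳ-< i (ℤ.+<+ (ℕP.n<1+n m))

i<i+[1+m] : ∀ i m → i ℤ.< i + + suc m
i<i+[1+m] i m = ℤP.≤-<-trans (ℤP.i≤i+j i (+ m)) (i+m<i+[1+m] i m)

i+[1+m]-1≡i+m : ∀ i m → i + + suc m - + 1 ≡ i + + m
i+[1+m]-1≡i+m i m = trans (cong (λ d → i + d - + 1) (ℤP.pos-+ 1 m)) (ring i (+ m))
  where
  ring : ∀ i m → i + (+ 1 + m) - + 1 ≡ i + m
  ring = solve-∀

<⇒+1≤ : ∀ {i j} → i ℤ.< j → i + + 1 ℤ.≤ j
<⇒+1≤ {i} i<j = subst (ℤ._≤ _) (ℤP.+-comm (+ 1) i) (ℤP.i<j⇒suc[i]≤j i<j)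

<⇒≤-1 : ∀ {i j} → i ℤ.< j → i ℤ.≤ j - + 1
<⇒≤-1 {i} {j} i<j = subst (ℤ._≤ j - + 1) (ring i) (ℤP.+-monoˡ-≤ (- + 1) (<⇒+1≤ i<j))
  where
  ring : ∀ i → i + + 1 - + 1 ≡ i
  ring = solve-∀

<-+suc⇒≤ : ∀ {i} j m → i ℤ.< j + + suc m → i ℤ.≤ j + + m
<-+suc⇒≤ j m i< = subst (_ ℤ.≤_) (i+[1+m]-1≡i+m j m) (<⇒≤-1 i<)

ℤ-constant : ∀ {A : Set} (F : ℤ → A) → (∀ c → F c ≡ F (c - + 1)) → ∀ c → F c ≡ F (+ 0)
ℤ-constant F step (+ zero)     = refl
ℤ-constant F step (+ suc m)    = trans (step (+ suc m)) (ℤ-constant F step (+ m))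
ℤ-constant F step -[1+ zero ]  = sym (step (+ 0))
ℤ-constant F step -[1+ suc m ] = begin
  F -[1+ suc m ]      ≡⟨ cong (λ k → F -[1+ suc k ]) (sym (ℕP.+-identityʳ m)) ⟩
  F (-[1+ m ] - + 1)  ≡⟨ sym (step -[1+ m ]) ⟩
  F -[1+ m ]          ≡⟨ ℤ-constant F step -[1+ m ] ⟩
  F (+ 0)             ∎
  where open ≡-Reasoning

bounded-∃? : ∀ {P : ℤ → Set} → (∀ l → Dec (P l)) → ∀ lo hi → (∀ {l} → P l → lo ℤ.≤ l × l ℤ.≤ hi) → Dec (∃ P)
bounded-∃? {P} P? lo hi bounds = map′ found search (ℕP.anyUpTo? (λ m → P? (lo + + m)) (suc ∣ hi - lo ∣))
  where
  found : (∃ λ m → m ℕ.< suc ∣ hi - lo ∣ × P (lo + + m)) → ∃ P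
  found (m , _ , p) = lo + + m , p
  search : ∃ P → ∃ λ m → m ℕ.< suc ∣ hi - lo ∣ × P (lo + + m)
  search (l , p) =
    let m , m≤ , l≡ = offset-within (proj₁ (bounds p)) (proj₂ (bounds p))
    in  m , ℕ.s≤s m≤ , subst P l≡ p

remainder-unique : ∀ {d r r′} q q′ → r ℕ.< d → r′ ℕ.< d → + r + q ℤ.* + d ≡ + r′ + q′ ℤ.* + d → r ≡ r′
remainder-unique {d} {r} {r′} q q′ r<d r′<d e = by-cmp (ℤP.<-cmp q q′)
  where
  gap : ∀ {r r′ q q′} → q ℤ.< q′ → r ℕ.< d → + r + q ℤ.* + d ≢ + r′ + q′ ℤ.* + d
  gap {r} {r′} {q} q<q′ r<d e with <-offset q<q′
  ... | t , refl = ℕP.<⇒≱ r<d (subst (d ℕ.≤_) (sym r≡) (ℕP.≤-trans (ℕP.m≤m+n d (t ℕ.* d)) (ℕP.m≤n+m _ r′)))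
    where
    ring : ∀ r′ q t d → r′ + (q + t) ℤ.* d ≡ (r′ + t ℤ.* d) + q ℤ.* d
    ring = solve-∀
    r≡ : r ≡ r′ ℕ.+ suc t ℕ.* d
    r≡ = ℤP.+-injective (begin
      + r                             ≡⟨ +-cancelʳ-≡ (q ℤ.* + d) (trans e (ring (+ r′) q (+ suc t) (+ d))) ⟩
      + r′ + + suc t ℤ.* + d          ≡⟨ cong (λ z → + r′ + z) (sym (ℤP.pos-* (suc t) d)) ⟩
      + r′ + + (suc t ℕ.* d)          ≡⟨ sym (ℤP.pos-+ r′ (suc t ℕ.* d)) ⟩
      + (r′ ℕ.+ suc t ℕ.* d)          ∎)
      where open ≡-Reasoning
  by-cmp : Tri (q ℤ.< q′) (q ≡ q′) (q′ ℤ.< q) → r ≡ r′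
  by-cmp (tri< q<q′ _ _) = ⊥-elim (gap q<q′ r<d e)
  by-cmp (tri≈ _ refl _) = ℤP.+-injective (+-cancelʳ-≡ (q ℤ.* + d) e)
  by-cmp (tri> _ _ q′<q) = ⊥-elim (gap q′<q r′<d (sym e))

%ℕ-periodic : ∀ d .{{_ : NonZero d}} i → (i + + d) ℤ.%ℕ d ≡ i ℤ.%ℕ d
%ℕ-periodic d i =
  remainder-unique ((i + + d) ℤ./ℕ d) (i ℤ./ℕ d + + 1) (n%ℕd<d (i + + d) d) (n%ℕd<d i d) (begin
  + ((i + + d) ℤ.%ℕ d) + ((i + + d) ℤ./ℕ d) ℤ.* + d   ≡⟨ sym (a≡a%ℕn+[a/ℕn]*n (i + + d) d) ⟩
  i + + d                                           ≡⟨ cong (λ j → j + + d) (a≡a%ℕn+[a/ℕn]*n i d) ⟩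
  + (i ℤ.%ℕ d) + (i ℤ./ℕ d) ℤ.* + d + + d           ≡⟨ ring (+ (i ℤ.%ℕ d)) (i ℤ./ℕ d) (+ d) ⟩
  + (i ℤ.%ℕ d) + (i ℤ./ℕ d + + 1) ℤ.* + d           ∎)
  where
  open ≡-Reasoning
  ring : ∀ r q d → r + q ℤ.* d + d ≡ r + (q + + 1) ℤ.* d
  ring = solve-∀

≤∧≢⇒< : ∀ {p q : ℚ} → p ℚ.≤ q → p ≢ q → p ℚ.< q
≤∧≢⇒< {p} {q} p≤q p≢q with ℚP.<-cmp p q
... | tri< p<q _ _ = p<q
... | tri≈ _ p≡q _ = ⊥-elim (p≢q p≡q)
... | tri> _ _ q<p = ⊥-elim (ℚP.<-irrefl refl (ℚP.≤-<-trans p≤q q<p))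

p-q≡0⇒p≡q : ∀ {p q : ℚ} → p ℚ.- q ≡ 0ℚ → p ≡ q
p-q≡0⇒p≡q {p} {q} = ℚ-+-group.x∙y⁻¹≈ε⇒x≈y p q
  where module ℚ-+-group = GroupProperties ℚP.+-0-group

p-q≡r-s⇒p-r≡q-s : ∀ p q r s → p ℚ.- q ≡ r ℚ.- s → p ℚ.- r ≡ q ℚ.- s
p-q≡r-s⇒p-r≡q-s p q r s e = begin
  p ℚ.- r                 ≡⟨ split p q r ⟩
  (p ℚ.- q) ℚ.+ (q ℚ.- r) ≡⟨ cong (ℚ._+ (q ℚ.- r)) e ⟩
  (r ℚ.- s) ℚ.+ (q ℚ.- r) ≡⟨ merge q r s ⟩
  q ℚ.- s                 ∎
  where
  open ≡-Reasoning
  split : ∀ p q r → p ℚ.- r ≡ (p ℚ.- q) ℚ.+ (q ℚ.- r)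
  split = solve 3 (λ p q r → p :- r := (p :- q) :+ (q :- r)) refl
  merge : ∀ q r s → (r ℚ.- s) ℚ.+ (q ℚ.- r) ≡ q ℚ.- s
  merge = solve 3 (λ q r s → (r :- s) :+ (q :- r) := q :- s) refl

p-q≡r⇒p≡q+r : ∀ {p q r} → p ℚ.- q ≡ r → p ≡ q ℚ.+ r
p-q≡r⇒p≡q+r {p} {q} refl = split p q
  where
  split : ∀ p q → p ≡ q ℚ.+ (p ℚ.- q)
  split = solve 2 (λ p q → p := q :+ (p :- q)) refl

p+q-q≡p : ∀ p q → p ℚ.+ q ℚ.- q ≡ p
p+q-q≡p = solve 2 (λ p q → p :+ q :- q := p) refl

p+[q-p]≡q : ∀ p q → p ℚ.+ (q ℚ.- p) ≡ q
p+[q-p]≡q = solve 2 (λ p q → p :+ (q :- p) := q) refl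

-p+[p+q]≡q : ∀ p q → ℚ.- p ℚ.+ (p ℚ.+ q) ≡ q
-p+[p+q]≡q = solve 2 (λ p q → :- p :+ (p :+ q) := q) refl

q≡r⇒p+[q-r]≡p : ∀ p {q r} → q ≡ r → p ℚ.+ (q ℚ.- r) ≡ p
q≡r⇒p+[q-r]≡p p {q} refl = trans (cong (p ℚ.+_) (ℚP.+-inverseʳ q)) (ℚP.+-identityʳ p)

p+q≡p⇒q≡0 : ∀ {p q} → p ℚ.+ q ≡ p → q ≡ 0ℚ
p+q≡p⇒q≡0 {p} {q} e = begin
  q                      ≡⟨ sym (-p+[p+q]≡q p q) ⟩
  ℚ.- p ℚ.+ (p ℚ.+ q)    ≡⟨ cong (ℚ.- p ℚ.+_) e ⟩
  ℚ.- p ℚ.+ p            ≡⟨ ℚP.+-inverseˡ p ⟩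
  0ℚ                     ∎
  where open ≡-Reasoning

+-cancelˡ-≤ : ∀ p {q r} → p ℚ.+ q ℚ.≤ p ℚ.+ r → q ℚ.≤ r
+-cancelˡ-≤ p {q} {r} p+q≤p+r = begin
  q                      ≡⟨ sym (-p+[p+q]≡q p q) ⟩
  ℚ.- p ℚ.+ (p ℚ.+ q)    ≤⟨ ℚP.+-monoʳ-≤ (ℚ.- p) p+q≤p+r ⟩
  ℚ.- p ℚ.+ (p ℚ.+ r)    ≡⟨ -p+[p+q]≡q p r ⟩
  r                      ∎
  where open ℚP.≤-Reasoning

+-cancelʳ-≤ : ∀ r {p q} → p ℚ.+ r ℚ.≤ q ℚ.+ r → p ℚ.≤ q
+-cancelʳ-≤ r {p} {q} p+r≤q+r = +-cancelˡ-≤ r (subst₂ ℚ._≤_ (ℚP.+-comm p r) (ℚP.+-comm q r) p+r≤q+r)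

p<q⇒0<q-p : ∀ {p q} → p ℚ.< q → 0ℚ ℚ.< q ℚ.- p
p<q⇒0<q-p {p} {q} p<q = subst (ℚ._< q ℚ.- p) (ℚP.+-inverseʳ p) (ℚP.+-monoˡ-< (ℚ.- p) p<q)

+-[-]-mono-≤ : ∀ {p p′ q q′ r r′} → p ℚ.≤ p′ → q ℚ.≤ q′ → r′ ℚ.≤ r → p ℚ.+ (q ℚ.- r) ℚ.≤ p′ ℚ.+ (q′ ℚ.- r′)
+-[-]-mono-≤ p≤p′ q≤q′ r′≤r = ℚP.+-mono-≤ p≤p′ (ℚP.+-mono-≤ q≤q′ (ℚP.neg-antimono-≤ r′≤r))

⊓-preserves-pos : ∀ {p q} → 0ℚ ℚ.< p → 0ℚ ℚ.< q → 0ℚ ℚ.< p ℚ.⊓ q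
⊓-preserves-pos {p} {q} p>0 q>0 with ℚP.⊓-sel p q
... | inj₁ p⊓q≡p = subst (0ℚ ℚ.<_) (sym p⊓q≡p) p>0
... | inj₂ p⊓q≡q = subst (0ℚ ℚ.<_) (sym p⊓q≡q) q>0

positive-lower-bound : (g : ℕ → ℚ) (c : ℕ) {ε₀ : ℚ} → 0ℚ ℚ.< ε₀ →
  ∃ λ ε → 0ℚ ℚ.< ε × ε ℚ.≤ ε₀ × (∀ m → m ℕ.< c → 0ℚ ℚ.< g m → ε ℚ.≤ g m)
positive-lower-bound g zero    {ε₀} ε₀>0 = ε₀ , ε₀>0 , ℚP.≤-refl , λ _ ()
positive-lower-bound g (suc c) ε₀>0 with positive-lower-bound g c ε₀>0 | 0ℚ ℚ.<? g c
... | ε , ε>0 , ε≤ε₀ , bound | yes gc>0 =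
  ε ℚ.⊓ g c , ⊓-preserves-pos ε>0 gc>0 , ℚP.≤-trans (ℚP.p⊓q≤p ε (g c)) ε≤ε₀ , bound′
  where
  bound′ : ∀ m → m ℕ.< suc c → 0ℚ ℚ.< g m → ε ℚ.⊓ g c ℚ.≤ g m
  bound′ m m<1+c gm>0 with ℕP.m<1+n⇒m<n∨m≡n m<1+c
  ... | inj₁ m<c  = ℚP.≤-trans (ℚP.p⊓q≤p ε (g c)) (bound m m<c gm>0)
  ... | inj₂ refl = ℚP.p⊓q≤q ε (g c)
... | ε , ε>0 , ε≤ε₀ , bound | no gc≯0 = ε , ε>0 , ε≤ε₀ , bound′
  where
  bound′ : ∀ m → m ℕ.< suc c → 0ℚ ℚ.< g m → ε ℚ.≤ g m
  bound′ m m<1+c gm>0 with ℕP.m<1+n⇒m<n∨m≡n m<1+c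
  ... | inj₁ m<c  = bound m m<c gm>0
  ... | inj₂ refl = ⊥-elim (gc≯0 gm>0)

positive-lower-bound-on : (g : ℤ → ℚ) (lo hi : ℤ) {ε₀ : ℚ} → 0ℚ ℚ.< ε₀ →
  ∃ λ ε → 0ℚ ℚ.< ε × ε ℚ.≤ ε₀ × (∀ i → lo ℤ.≤ i → i ℤ.≤ hi → 0ℚ ℚ.< g i → ε ℚ.≤ g i)
positive-lower-bound-on g lo hi ε₀>0 =
  let ε , ε>0 , ε≤ε₀ , bound = positive-lower-bound (λ m → g (lo + + m)) (suc ∣ hi - lo ∣) ε₀>0
      bound′ : ∀ i → lo ℤ.≤ i → i ℤ.≤ hi → 0ℚ ℚ.< g i → ε ℚ.≤ g i
      bound′ i lo≤i i≤hi gi>0 =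
        let m , m≤ , i≡ = offset-within lo≤i i≤hi
        in  subst (λ l → ε ℚ.≤ g l) (sym i≡) (bound m (ℕ.s≤s m≤) (subst (λ l → 0ℚ ℚ.< g l) i≡ gi>0))
  in  ε , ε>0 , ε≤ε₀ , bound′

antitone-by-steps : ∀ (f : ℤ → ℚ) → (∀ j → f (j + + 1) ℚ.≤ f j) → ∀ {i j} → i ℤ.≤ j → f j ℚ.≤ f i
antitone-by-steps f step {i} i≤j with ≤-offset i≤j
... | d , refl = go d
  where
  go : ∀ d → f (i + + d) ℚ.≤ f i
  go zero    = ℚP.≤-reflexive (cong f (ℤP.+-identityʳ i))
  go (suc d) = ℚP.≤-trans (subst (λ l → f l ℚ.≤ f (i + + d)) (i+m+1≡i+[1+m] d) (step (i + + d))) (go d)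
    where
    i+m+1≡i+[1+m] : ∀ d → i + + d + + 1 ≡ i + + suc d
    i+m+1≡i+[1+m] d = trans (ℤP.+-assoc i (+ d) (+ 1)) (cong (λ k → i + k) (ℤP.+-comm (+ d) (+ 1)))

antitone-level-unique : ∀ (f : ℤ → ℚ) → (∀ j → f (j + + 1) ℚ.≤ f j) → ∀ {j₀ j} →
  f (j₀ + + 1) ℚ.< f j₀ → f j₀ ℚ.< f (j₀ - + 1) → f j ≡ f j₀ → j ≡ j₀
antitone-level-unique f step {j₀} {j} drop-after drop-before fj≡fj₀ = by-cmp (ℤP.<-cmp j j₀)
  where
  by-cmp : Tri (j ℤ.< j₀) (j ≡ j₀) (j₀ ℤ.< j) → j ≡ j₀
  by-cmp (tri≈ _ j≡j₀ _) = j≡j₀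
  by-cmp (tri> _ _ j₀<j) =
    ⊥-elim (ℚP.<-irrefl fj≡fj₀ (ℚP.≤-<-trans (antitone-by-steps f step (<⇒+1≤ j₀<j)) drop-after))
  by-cmp (tri< j<j₀ _ _) =
    ⊥-elim (ℚP.<-irrefl (sym fj≡fj₀) (ℚP.<-≤-trans drop-before (antitone-by-steps f step (<⇒≤-1 j<j₀))))

fromℕℚ≡mkℚ : ∀ m → fromℕℚ m ≡ mkℚ (+ m) 0 (Coprimality.sym (Coprimality.1-coprimeTo m))
fromℕℚ≡mkℚ m = ℚP.normalize-coprime (Coprimality.sym (Coprimality.1-coprimeTo m))

fromℕℚ-+ : ∀ p q → fromℕℚ (p ℕ.+ q) ≡ fromℕℚ p ℚ.+ fromℕℚ q
fromℕℚ-+ p q rewrite fromℕℚ≡mkℚ p | fromℕℚ≡mkℚ q =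
  cong (ℚ._/ 1) (trans (ℤP.pos-+ p q) (sym (cong₂ _+_ (ℤP.*-identityʳ (+ p)) (ℤP.*-identityʳ (+ q)))))

fromℕℚ-pos : ∀ {m} → 0 < m → 0ℚ ℚ.< fromℕℚ m
fromℕℚ-pos {suc m} _ = ℚP.positive⁻¹ (fromℕℚ (suc m)) {{ℚP.normalize-pos (suc m) 1}}

sum-tabulate-pos : ∀ c (f : Fin c → ℕ) → 0 < c → (∀ i → 0 < f i) → 0 < sum (tabulate f)
sum-tabulate-pos (suc c) f _ f>0 = ℕP.<-≤-trans (f>0 Fin.zero) (ℕP.m≤m+n _ _)

-- Prefix sums

-- Anchored at 0, so that prefix f d - prefix f c = f (c+1) + … + f d for c ≤ d.
prefix : (ℤ → ℚ) → ℤ → ℚ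
prefix f (+ zero)      = 0ℚ
prefix f (+ suc m)     = prefix f (+ m) ℚ.+ f (+ suc m)
prefix f -[1+ zero ]   = ℚ.- f (+ 0)
prefix f -[1+ suc m ]  = prefix f -[1+ m ] ℚ.- f -[1+ m ]

module _ (f : ℤ → ℚ) where

  prefix-pred : ∀ b → prefix f b ≡ prefix f (b - + 1) ℚ.+ f b
  prefix-pred (+ zero)   = sym (ℚP.+-inverseˡ (f (+ 0)))
  prefix-pred (+ suc m)  = refl
  prefix-pred -[1+ m ] rewrite ℕP.+-identityʳ m = cancel (prefix f -[1+ m ]) (f -[1+ m ])
    where
    cancel : ∀ p y → p ≡ (p ℚ.- y) ℚ.+ y
    cancel = solve 2 (λ p y → p := (p :- y) :+ y) refl

  prefix-unique : (F : ℤ → ℚ) → F (+ 0) ≡ 0ℚ → (∀ b → F b ≡ F (b - + 1) ℚ.+ f b) →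
                  ∀ b → F b ≡ prefix f b
  prefix-unique F F0 F-pred b = p-q≡0⇒p≡q (trans (ℤ-constant G G-pred b) G0)
    where
    G : ℤ → ℚ
    G c = F c ℚ.- prefix f c
    G0 : G (+ 0) ≡ 0ℚ
    G0 = cong (ℚ._- 0ℚ) F0
    G-pred : ∀ c → G c ≡ G (c - + 1)
    G-pred c = trans (cong₂ ℚ._-_ (F-pred c) (prefix-pred c))
                     (shift (F (c - + 1)) (prefix f (c - + 1)) (f c))
      where
      shift : ∀ p q y → (p ℚ.+ y) ℚ.- (q ℚ.+ y) ≡ p ℚ.- q
      shift = solve 3 (λ p q y → (p :+ y) :- (q :+ y) := p :- q) refl

  prefix-pred-0 : ∀ {b} → f b ≡ 0ℚ → prefix f b ≡ prefix f (b - + 1)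
  prefix-pred-0 {b} fb≡0 = trans (prefix-pred b) (trans (cong (prefix f (b - + 1) ℚ.+_) fb≡0) (ℚP.+-identityʳ _))

  prefix-vanish : ∀ {c d} → c ℤ.≤ d → (∀ l → c ℤ.< l → l ℤ.≤ d → f l ≡ 0ℚ) → prefix f d ≡ prefix f c
  prefix-vanish {c} c≤d f≡0 with ≤-offset c≤d
  ... | m , refl = go m f≡0
    where
    go : ∀ m → (∀ l → c ℤ.< l → l ℤ.≤ c + + m → f l ≡ 0ℚ) → prefix f (c + + m) ≡ prefix f c
    go zero    _   = cong (prefix f) (ℤP.+-identityʳ c)
    go (suc m) f≡0 = begin
      prefix f (c + + suc m)        ≡⟨ prefix-pred-0 (f≡0 _ (i<i+[1+m] c m) ℤP.≤-refl) ⟩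
      prefix f (c + + suc m - + 1)  ≡⟨ cong (prefix f) (i+[1+m]-1≡i+m c m) ⟩
      prefix f (c + + m)            ≡⟨ go m (λ l c<l l≤ → f≡0 l c<l (ℤP.≤-trans l≤ (ℤP.<⇒≤ (i+m<i+[1+m] c m)))) ⟩
      prefix f c                    ∎
      where open ≡-Reasoning

  prefix-mono-≤ : (∀ l → 0ℚ ℚ.≤ f l) → ∀ {c d} → c ℤ.≤ d → prefix f c ℚ.≤ prefix f d
  prefix-mono-≤ f≥0 {c} c≤d with ≤-offset c≤d
  ... | m , refl = go m
    where
    go : ∀ m → prefix f c ℚ.≤ prefix f (c + + m)
    go zero    = ℚP.≤-reflexive (cong (prefix f) (sym (ℤP.+-identityʳ c)))
    go (suc m) = begin
      prefix f c                                       ≤⟨ go m ⟩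
      prefix f (c + + m)                               ≡⟨ sym (ℚP.+-identityʳ _) ⟩
      prefix f (c + + m) ℚ.+ 0ℚ                        ≤⟨ ℚP.+-monoʳ-≤ (prefix f (c + + m)) (f≥0 (c + + suc m)) ⟩
      prefix f (c + + m) ℚ.+ f (c + + suc m)           ≡⟨ cong (λ b → prefix f b ℚ.+ f (c + + suc m)) m≡ ⟩
      prefix f (c + + suc m - + 1) ℚ.+ f (c + + suc m) ≡⟨ sym (prefix-pred (c + + suc m)) ⟩
      prefix f (c + + suc m)                           ∎
      where
      open ℚP.≤-Reasoning
      m≡ : c + + m ≡ c + + suc m - + 1
      m≡ = sym (i+[1+m]-1≡i+m c m)

  last-nonzero : ∀ {c d} → c ℤ.≤ d → prefix f d ≢ prefix f c →
                 ∃ λ t → c ℤ.< t × t ℤ.≤ d × f t ≢ 0ℚ × prefix f d ≡ prefix f t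
  last-nonzero {c} c≤d with ≤-offset c≤d
  ... | m , refl = go m
    where
    go : ∀ m → prefix f (c + + m) ≢ prefix f c →
         ∃ λ t → c ℤ.< t × t ℤ.≤ c + + m × f t ≢ 0ℚ × prefix f (c + + m) ≡ prefix f t
    go zero    P≢ = ⊥-elim (P≢ (cong (prefix f) (ℤP.+-identityʳ c)))
    go (suc m) P≢ with f (c + + suc m) ℚP.≟ 0ℚ
    ... | no  f≢0 = _ , i<i+[1+m] c m , ℤP.≤-refl , f≢0 , refl
    ... | yes f≡0 =
      let t , c<t , t≤ , ft≢0 , P≡ = go m (λ P≡ → P≢ (trans P-step P≡))
      in  t , c<t , ℤP.≤-trans t≤ (ℤP.<⇒≤ (i+m<i+[1+m] c m)) , ft≢0 , trans P-step P≡
      where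
      P-step : prefix f (c + + suc m) ≡ prefix f (c + + m)
      P-step = trans (prefix-pred-0 f≡0) (cong (prefix f) (i+[1+m]-1≡i+m c m))

prefix-sub : ∀ f g b → prefix (λ l → f l ℚ.- g l) b ≡ prefix f b ℚ.- prefix g b
prefix-sub f g b = sym (prefix-unique _ (λ c → prefix f c ℚ.- prefix g c) (ℚP.+-inverseʳ 0ℚ) step b)
  where
  step : ∀ c → prefix f c ℚ.- prefix g c ≡ (prefix f (c - + 1) ℚ.- prefix g (c - + 1)) ℚ.+ (f c ℚ.- g c)
  step c = trans (cong₂ ℚ._-_ (prefix-pred f c) (prefix-pred g c))
                 (regroup (prefix f (c - + 1)) (prefix g (c - + 1)) (f c) (g c))
    where
    regroup : ∀ p q y z → (p ℚ.+ y) ℚ.- (q ℚ.+ z) ≡ (p ℚ.- q) ℚ.+ (y ℚ.- z)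
    regroup = solve 4 (λ p q y z → (p :+ y) :- (q :+ z) := (p :- q) :+ (y :- z)) refl

prefix-cong-on : ∀ f g {c d} → c ℤ.≤ d → (∀ l → c ℤ.< l → l ℤ.≤ d → f l ≡ g l) →
                 prefix f d ℚ.- prefix f c ≡ prefix g d ℚ.- prefix g c
prefix-cong-on f g {c} {d} c≤d f≡g = p-q≡r-s⇒p-r≡q-s (prefix f d) (prefix g d) (prefix f c) (prefix g c) (begin
  prefix f d ℚ.- prefix g d         ≡⟨ sym (prefix-sub f g d) ⟩
  prefix (λ l → f l ℚ.- g l) d      ≡⟨ prefix-vanish _ c≤d (λ l c<l l≤d → f-g≡0 (f≡g l c<l l≤d)) ⟩
  prefix (λ l → f l ℚ.- g l) c      ≡⟨ prefix-sub f g c ⟩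
  prefix f c ℚ.- prefix g c         ∎)
  where
  open ≡-Reasoning
  f-g≡0 : ∀ {p q} → p ≡ q → p ℚ.- q ≡ 0ℚ
  f-g≡0 {p} refl = ℚP.+-inverseʳ p

sumCount≡prefix : ∀ f L c → sumCount L c f ≡ prefix f (L - + 1 + + c) ℚ.- prefix f (L - + 1)
sumCount≡prefix f L zero =
  sym (trans (cong (λ b → prefix f b ℚ.- prefix f (L - + 1)) (ℤP.+-identityʳ (L - + 1)))
             (ℚP.+-inverseʳ (prefix f (L - + 1))))
sumCount≡prefix f L (suc c) = begin
  f L ℚ.+ sumCount (L + + 1) c f
    ≡⟨ cong (f L ℚ.+_) (sumCount≡prefix f (L + + 1) c) ⟩
  f L ℚ.+ (prefix f (L + + 1 - + 1 + + c) ℚ.- prefix f (L + + 1 - + 1))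
    ≡⟨ cong₂ (λ b b′ → f L ℚ.+ (prefix f b ℚ.- prefix f b′)) (shift L c) (L+1-1≡L L) ⟩
  f L ℚ.+ (prefix f (L - + 1 + + suc c) ℚ.- prefix f L)
    ≡⟨ cong (λ p → f L ℚ.+ (prefix f (L - + 1 + + suc c) ℚ.- p)) (prefix-pred f L) ⟩
  f L ℚ.+ (prefix f (L - + 1 + + suc c) ℚ.- (prefix f (L - + 1) ℚ.+ f L))
    ≡⟨ cancel (f L) (prefix f (L - + 1 + + suc c)) (prefix f (L - + 1)) ⟩
  prefix f (L - + 1 + + suc c) ℚ.- prefix f (L - + 1)
    ∎
  where
  open ≡-Reasoning
  shift : ∀ L c → L + + 1 - + 1 + + c ≡ L - + 1 + + suc c
  shift L c = trans (ring L (+ c)) (cong (λ d → L - + 1 + d) (sym (ℤP.pos-+ 1 c)))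
    where
    ring : ∀ L c → L + + 1 - + 1 + c ≡ L - + 1 + (+ 1 + c)
    ring = solve-∀
  L+1-1≡L : ∀ L → L + + 1 - + 1 ≡ L
  L+1-1≡L = solve-∀
  cancel : ∀ y p q → y ℚ.+ (p ℚ.- (q ℚ.+ y)) ≡ p ℚ.- q
  cancel = solve 3 (λ y p q → y :+ (p :- (q :+ y)) := p :- q) refl

sumFromTo≡prefix : ∀ f L U → (∀ l → U ℤ.< l → l ℤ.≤ L - + 1 → f l ≡ 0ℚ) →
                   sumFromTo L U f ≡ prefix f U ℚ.- prefix f (L - + 1)
sumFromTo≡prefix f L U f≡0 = go (U - L + + 1) refl
  where
  U≡ : U ≡ L - + 1 + (U - L + + 1)
  U≡ = ring L U
    where
    ring : ∀ L U → U ≡ L - + 1 + (U - L + + 1)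
    ring = solve-∀
  go : ∀ z → U - L + + 1 ≡ z → sumCount L (clamp z) f ≡ prefix f U ℚ.- prefix f (L - + 1)
  go (+ c)    eq = trans (sumCount≡prefix f L c) (cong (λ b → prefix f b ℚ.- prefix f (L - + 1)) (sym U≡L-1+c))
    where
    U≡L-1+c : U ≡ L - + 1 + + c
    U≡L-1+c = trans U≡ (cong (λ d → L - + 1 + d) eq)
  go -[1+ c ] eq = sym (trans (cong (λ p → prefix f U ℚ.- p) (prefix-vanish f U≤L-1 f≡0))
                              (ℚP.+-inverseʳ (prefix f U)))
    where
    U≤L-1 : U ℤ.≤ L - + 1
    U≤L-1 = ℤP.i-j≤0⇒i≤j (subst (ℤ._≤ + 0) (trans (sym eq) (ring U L)) (ℤP.<⇒≤ ℤ.-<+))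
      where
      ring : ∀ U L → U - L + + 1 ≡ U - (L - + 1)
      ring = solve-∀

sumCount-tabulate : ∀ c s (f : Fin c → ℕ) (h : ℤ → ℚ) → (∀ i → h (+ (s ℕ.+ toℕ i)) ≡ fromℕℚ (f i)) →
                    sumCount (+ s) c h ≡ fromℕℚ (sum (tabulate f))
sumCount-tabulate zero    s f h h≡f = refl
sumCount-tabulate (suc c) s f h h≡f = begin
  h (+ s) ℚ.+ sumCount (+ (s ℕ.+ 1)) c h
    ≡⟨ cong₂ ℚ._+_ (trans (cong (λ m → h (+ m)) (sym (ℕP.+-identityʳ s))) (h≡f Fin.zero))
                   (sumCount-tabulate c (s ℕ.+ 1) (f ∘ Fin.suc) h
                      (λ i → trans (cong (λ m → h (+ m)) (ℕP.+-assoc s 1 (toℕ i))) (h≡f (Fin.suc i)))) ⟩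
  fromℕℚ (f Fin.zero) ℚ.+ fromℕℚ (sum (tabulate (f ∘ Fin.suc)))
    ≡⟨ sym (fromℕℚ-+ (f Fin.zero) _) ⟩
  fromℕℚ (sum (tabulate f))
    ∎
  where open ≡-Reasoning

-- Windows and the sums s

module Sums (n : ℕ) {{_ : NonZero n}} (a : Fin n → ℕ) where
  open Setup n a

  1≤n : 1 ℕ.≤ n
  1≤n = ℕ.>-nonZero⁻¹ n

  i≤i+[n-1] : ∀ i → i ℤ.≤ i + (+ n - + 1)
  i≤i+[n-1] i = ℤP.≤-trans (ℤP.≤-reflexive (sym (ℤP.+-identityʳ i))) (ℤP.+-monoʳ-≤ i (ℤP.i≤j⇒0≤j-i (ℤ.+≤+ 1≤n)))

  i-n≤i-1 : ∀ i → i - + n ℤ.≤ i - + 1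
  i-n≤i-1 i = ℤP.+-monoʳ-≤ i (ℤP.neg-mono-≤ (ℤ.+≤+ 1≤n))

  i-n<i : ∀ i → i - + n ℤ.< i
  i-n<i i = ℤP.≤-<-trans (i-n≤i-1 i) (i-1<i i)

  window-start-≤ : ∀ {c t} → t ℤ.≤ c + (+ n - + 1) → t - + n + + 1 ℤ.≤ c
  window-start-≤ {c} {t} t≤ = subst₂ ℤ._≤_ (ring₁ t (+ n)) (ring₂ c (+ n)) (ℤP.+-monoˡ-≤ (+ 1 - + n) t≤)
    where
    ring₁ : ∀ t n → t + (+ 1 - n) ≡ t - n + + 1
    ring₁ = solve-∀
    ring₂ : ∀ c n → c + (n - + 1) + (+ 1 - n) ≡ c
    ring₂ = solve-∀

  aℤ-periodic : ∀ l → aℤ (l + + n) ≡ aℤ l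
  aℤ-periodic l = cong (λ i → fromℕℚ (a i)) (FinP.fromℕ<-cong _ _ (%ℕ-periodic n l) _ _)

  aℤ-pos : (∀ i → 0 < a i) → ∀ l → 0ℚ ℚ.< aℤ l
  aℤ-pos a>0 l = fromℕℚ-pos (a>0 _)

  k≡sum-tabulate : k ≡ sum (tabulate a)
  k≡sum-tabulate = cong sum (ListP.map-tabulate (λ i → i) a)

  k-pos : (∀ i → 0 < a i) → 0ℚ ℚ.< fromℕℚ k
  k-pos a>0 = fromℕℚ-pos (subst (0 <_) (sym k≡sum-tabulate) (sum-tabulate-pos n a 1≤n a>0))

  period-sum : ∀ c → prefix aℤ (c + + n) ℚ.- prefix aℤ c ≡ fromℕℚ k
  period-sum c = begin
    Q c                           ≡⟨ ℤ-constant Q Q-pred c ⟩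
    Q (+ 0)                       ≡⟨ Q-pred (+ 0) ⟩
    Q (+ 0 - + 1)                 ≡⟨ sym (sumCount≡prefix aℤ (+ 0) n) ⟩
    sumCount (+ 0) n aℤ           ≡⟨ sumCount-tabulate n 0 a aℤ aℤ-toℕ ⟩
    fromℕℚ (sum (tabulate a))     ≡⟨ cong fromℕℚ (sym k≡sum-tabulate) ⟩
    fromℕℚ k                      ∎
    where
    open ≡-Reasoning
    Q : ℤ → ℚ
    Q c = prefix aℤ (c + + n) ℚ.- prefix aℤ c
    Q-pred : ∀ c → Q c ≡ Q (c - + 1)
    Q-pred c = begin
      prefix aℤ (c + + n) ℚ.- prefix aℤ c
        ≡⟨ cong₂ ℚ._-_ (prefix-pred aℤ (c + + n)) (prefix-pred aℤ c) ⟩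
      (prefix aℤ (c + + n - + 1) ℚ.+ aℤ (c + + n)) ℚ.- (prefix aℤ (c - + 1) ℚ.+ aℤ c)
        ≡⟨ cong₂ (λ b y → (prefix aℤ b ℚ.+ y) ℚ.- (prefix aℤ (c - + 1) ℚ.+ aℤ c)) (ring c (+ n)) (aℤ-periodic c) ⟩
      (prefix aℤ (c - + 1 + + n) ℚ.+ aℤ c) ℚ.- (prefix aℤ (c - + 1) ℚ.+ aℤ c)
        ≡⟨ cancel (prefix aℤ (c - + 1 + + n)) (prefix aℤ (c - + 1)) (aℤ c) ⟩
      prefix aℤ (c - + 1 + + n) ℚ.- prefix aℤ (c - + 1)
        ∎
      where
      ring : ∀ c n → c + n - + 1 ≡ c - + 1 + n
      ring = solve-∀
      cancel : ∀ p q y → (p ℚ.+ y) ℚ.- (q ℚ.+ y) ≡ p ℚ.- q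
      cancel = solve 3 (λ p q y → (p :+ y) :- (q :+ y) := p :- q) refl
    aℤ-toℕ : ∀ i → aℤ (+ (0 ℕ.+ toℕ i)) ≡ fromℕℚ (a i)
    aℤ-toℕ i = cong (λ j → fromℕℚ (a j))
      (trans (FinP.fromℕ<-cong _ _ (m<n⇒m%n≡m (FinP.toℕ<n i)) _ (FinP.toℕ<n i)) (FinP.fromℕ<-toℕ i _))

  period-sum-at : ∀ c {d} → d ≡ c + + n → prefix aℤ d ℚ.- prefix aℤ c ≡ fromℕℚ k
  period-sum-at c refl = period-sum c

  window≡prefix : ∀ u i → window u i ≡ prefix (x u) i ℚ.- prefix (x u) (i - + n)
  window≡prefix u i =
    trans (sumFromTo≡prefix (x u) (i - + n + + 1) i no-gap)
          (cong (λ b → prefix (x u) i ℚ.- prefix (x u) b) (ring i (+ n)))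
    where
    ring : ∀ i n → i - n + + 1 - + 1 ≡ i - n
    ring = solve-∀
    no-gap : ∀ l → i ℤ.< l → l ℤ.≤ i - + n + + 1 - + 1 → x u l ≡ 0ℚ
    no-gap l i<l l≤ = ⊥-elim (ℤP.<-irrefl refl (ℤP.<-≤-trans i<l
                        (ℤP.≤-trans (subst (l ℤ.≤_) (ring i (+ n)) l≤) (ℤP.i-j≤i i (+ n)))))

  window-left-tail : ∀ u i → i ℤ.< - (+ N u) → window u i ≡ fromℕℚ k
  window-left-tail u i i<-N = begin
    window u i                                   ≡⟨ window≡prefix u i ⟩
    prefix (x u) i ℚ.- prefix (x u) (i - + n)    ≡⟨ prefix-cong-on (x u) aℤ (ℤP.i-j≤i i (+ n)) x≡a ⟩
    prefix aℤ i ℚ.- prefix aℤ (i - + n)          ≡⟨ period-sum-at (i - + n) (ring i (+ n)) ⟩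
    fromℕℚ k                                     ∎
    where
    open ≡-Reasoning
    x≡a : ∀ l → i - + n ℤ.< l → l ℤ.≤ i → x u l ≡ aℤ l
    x≡a l _ l≤i = left u l (ℤP.≤-<-trans l≤i i<-N)
    ring : ∀ i n → i ≡ i - n + n
    ring = solve-∀

  window-right-tail : ∀ u i → + N u ℤ.≤ i - + n → window u i ≡ 0ℚ
  window-right-tail u i N≤i-n = begin
    window u i                                          ≡⟨ window≡prefix u i ⟩
    prefix (x u) i ℚ.- prefix (x u) (i - + n)           ≡⟨ cong (ℚ._- prefix (x u) (i - + n)) x-vanishes ⟩
    prefix (x u) (i - + n) ℚ.- prefix (x u) (i - + n)   ≡⟨ ℚP.+-inverseʳ (prefix (x u) (i - + n)) ⟩
    0ℚ                                                  ∎
    where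
    open ≡-Reasoning
    x-vanishes : prefix (x u) i ≡ prefix (x u) (i - + n)
    x-vanishes = prefix-vanish (x u) (ℤP.i-j≤i i (+ n)) (λ l i-n<l _ → right u l (ℤP.≤-<-trans N≤i-n i-n<l))

  window-pred : ∀ u i → window u i ℚ.+ x u (i - + n) ≡ window u (i - + 1) ℚ.+ x u i
  window-pred u i = begin
    window u i ℚ.+ X (i - + n)
      ≡⟨ cong (ℚ._+ X (i - + n)) (window≡prefix u i) ⟩
    P i ℚ.- P (i - + n) ℚ.+ X (i - + n)
      ≡⟨ cong₂ (λ p q → p ℚ.- q ℚ.+ X (i - + n)) (prefix-pred X i) (prefix-pred X (i - + n)) ⟩
    (P (i - + 1) ℚ.+ X i) ℚ.- (P (i - + n - + 1) ℚ.+ X (i - + n)) ℚ.+ X (i - + n)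
      ≡⟨ cong (λ b → (P (i - + 1) ℚ.+ X i) ℚ.- (P b ℚ.+ X (i - + n)) ℚ.+ X (i - + n)) (ring i (+ n)) ⟩
    (P (i - + 1) ℚ.+ X i) ℚ.- (P (i - + 1 - + n) ℚ.+ X (i - + n)) ℚ.+ X (i - + n)
      ≡⟨ regroup (P (i - + 1)) (X i) (P (i - + 1 - + n)) (X (i - + n)) ⟩
    P (i - + 1) ℚ.- P (i - + 1 - + n) ℚ.+ X i
      ≡⟨ cong (ℚ._+ X i) (sym (window≡prefix u (i - + 1))) ⟩
    window u (i - + 1) ℚ.+ X i
      ∎
    where
    open ≡-Reasoning
    X P : ℤ → ℚ
    X = x u
    P = prefix X
    ring : ∀ i n → i - n - + 1 ≡ i - + 1 - n
    ring = solve-∀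
    regroup : ∀ p y q z → (p ℚ.+ y) ℚ.- (q ℚ.+ z) ℚ.+ z ≡ p ℚ.- q ℚ.+ y
    regroup = solve 4 (λ p y q z → (p :+ y) :- (q :+ z) :+ z := p :- q :+ y) refl

  pos : ℤ → ℤ → ℤ
  pos i j = i ℤ.* + n + j ℤ.* (+ n - + 1)

  pos-diag : ∀ i j → pos (i - + 1) (j + + 1) ≡ pos i j - + 1
  pos-diag i j = ring i j (+ n)
    where
    ring : ∀ i j n → (i - + 1) ℤ.* n + (j + + 1) ℤ.* (n - + 1) ≡ i ℤ.* n + j ℤ.* (n - + 1) - + 1
    ring = solve-∀

  pos-up : ∀ i j → pos (i - + 1) j ≡ pos i j - + n
  pos-up i j = ring i j (+ n)
    where
    ring : ∀ i j n → (i - + 1) ℤ.* n + j ℤ.* (n - + 1) ≡ i ℤ.* n + j ℤ.* (n - + 1) - n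
    ring = solve-∀

  pos-right : ∀ i j → pos i (j + + 1) ≡ pos i j + (+ n - + 1)
  pos-right i j = ring i j (+ n)
    where
    ring : ∀ i j n → i ℤ.* n + (j + + 1) ℤ.* (n - + 1) ≡ i ℤ.* n + j ℤ.* (n - + 1) + (n - + 1)
    ring = solve-∀

  offset : V → ℚ
  offset u = prefix (x u) (- (+ N u) - + 1) ℚ.- prefix aℤ (- (+ N u) - + 1)

  s≡prefix : ∀ i j u → s i j u ≡ prefix (x u) (pos i j) ℚ.- prefix aℤ ((i + j) ℤ.* + n) ℚ.- offset u
  s≡prefix i j u = begin
    s i j u
      ≡⟨ cong₂ ℚ._-_ first-sum second-sum ⟩
    (PX U ℚ.- PT U) ℚ.- (PX L′ ℚ.- PT L′) ℚ.- (PT mn ℚ.- PT U)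
      ≡⟨ regroup (PX U) (PT U) (PX L′) (PT L′) (PT mn) ⟩
    (PX U ℚ.- PX L′) ℚ.- (PT mn ℚ.- PT L′)
      ≡⟨ cong (λ q → (PX U ℚ.- PX L′) ℚ.- q) T≡a-below ⟩
    (PX U ℚ.- PX L′) ℚ.- (PA mn ℚ.- PA L′)
      ≡⟨ regroup′ (PX U) (PX L′) (PA mn) (PA L′) ⟩
    PX U ℚ.- PA mn ℚ.- (PX L′ ℚ.- PA L′)
      ≡⟨ cong (λ q → PX U ℚ.- PA mn ℚ.- q) (sym (p-q≡r-s⇒p-r≡q-s (PX c₀) (PX L′) (PA c₀) (PA L′) x≡a-below)) ⟩
    PX U ℚ.- PA mn ℚ.- offset u
      ∎
    where
    open ≡-Reasoning
    m mn U c₀ L L′ : ℤ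
    m = i + j
    mn = m ℤ.* + n
    U = pos i j
    c₀ = - (+ N u) - + 1
    L = c₀ ℤ.⊓ mn
    L′ = L - + 1
    PX PT PA : ℤ → ℚ
    PX = prefix (x u)
    PT = prefix (T m)
    PA = prefix aℤ
    L′<L : L′ ℤ.< L
    L′<L = i-1<i L
    L′≤mn : L′ ℤ.≤ mn
    L′≤mn = ℤP.<⇒≤ (ℤP.<-≤-trans L′<L (ℤP.i⊓j≤j c₀ mn))
    L′≤c₀ : L′ ℤ.≤ c₀
    L′≤c₀ = ℤP.<⇒≤ (ℤP.<-≤-trans L′<L (ℤP.i⊓j≤i c₀ mn))
    x-left : ∀ {l} → l ℤ.≤ c₀ → x u l ≡ aℤ l
    x-left l≤c₀ = left u _ (ℤP.≤-<-trans l≤c₀ (i-1<i (- (+ N u))))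
    T-low : ∀ {l} → l ℤ.≤ mn → T m l ≡ aℤ l
    T-low {l} l≤mn with l ℤ.≤? mn
    ... | yes _    = refl
    ... | no l≰mn = ⊥-elim (l≰mn l≤mn)
    T-high : ∀ {l} → mn ℤ.< l → T m l ≡ 0ℚ
    T-high {l} mn<l with l ℤ.≤? mn
    ... | yes l≤mn = ⊥-elim (ℤP.<-irrefl refl (ℤP.<-≤-trans mn<l l≤mn))
    ... | no _     = refl
    x-T≡0 : ∀ l → U ℤ.< l → l ℤ.≤ L′ → x u l ℚ.- T m l ≡ 0ℚ
    x-T≡0 l _ l≤L′ = trans (cong₂ ℚ._-_ (x-left (ℤP.≤-trans l≤L′ L′≤c₀)) (T-low (ℤP.≤-trans l≤L′ L′≤mn)))
                           (ℚP.+-inverseʳ (aℤ l))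
    T≡0 : ∀ l → mn ℤ.< l → l ℤ.≤ U + + 1 - + 1 → T m l ≡ 0ℚ
    T≡0 l mn<l _ = T-high mn<l
    x≡a-below : PX c₀ ℚ.- PX L′ ≡ PA c₀ ℚ.- PA L′
    x≡a-below = prefix-cong-on (x u) aℤ L′≤c₀ (λ l _ l≤c₀ → x-left l≤c₀)
    T≡a-below : PT mn ℚ.- PT L′ ≡ PA mn ℚ.- PA L′
    T≡a-below = prefix-cong-on (T m) aℤ L′≤mn (λ l _ l≤mn → T-low l≤mn)
    first-sum : sumFromTo L U (λ l → x u l ℚ.- T m l) ≡ (PX U ℚ.- PT U) ℚ.- (PX L′ ℚ.- PT L′)
    first-sum = trans (sumFromTo≡prefix (λ l → x u l ℚ.- T m l) L U x-T≡0)
                      (cong₂ ℚ._-_ (prefix-sub (x u) (T m) U) (prefix-sub (x u) (T m) L′))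
    ring : ∀ U → U + + 1 - + 1 ≡ U
    ring = solve-∀
    second-sum : sumFromTo (U + + 1) mn (T m) ≡ PT mn ℚ.- PT U
    second-sum = trans (sumFromTo≡prefix (T m) (U + + 1) mn T≡0) (cong (λ b → PT mn ℚ.- PT b) (ring U))
    regroup : ∀ xU tU xL tL tm → (xU ℚ.- tU) ℚ.- (xL ℚ.- tL) ℚ.- (tm ℚ.- tU) ≡ (xU ℚ.- xL) ℚ.- (tm ℚ.- tL)
    regroup = solve 5 (λ xU tU xL tL tm → (xU :- tU) :- (xL :- tL) :- (tm :- tU) := (xU :- xL) :- (tm :- tL)) refl
    regroup′ : ∀ xU xL am aL → (xU ℚ.- xL) ℚ.- (am ℚ.- aL) ≡ xU ℚ.- am ℚ.- (xL ℚ.- aL)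
    regroup′ = solve 4 (λ xU xL am aL → (xU :- xL) :- (am :- aL) := xU :- am :- (xL :- aL)) refl

  s-zero-edge : ∀ i j u → x u (pos i j) ≡ 0ℚ → s i j u ≡ s (i - + 1) (j + + 1) u
  s-zero-edge i j u x≡0 = begin
    s i j u
      ≡⟨ s≡prefix i j u ⟩
    prefix (x u) (pos i j) ℚ.- prefix aℤ ((i + j) ℤ.* + n) ℚ.- offset u
      ≡⟨ cong₂ (λ P q → P ℚ.- prefix aℤ q ℚ.- offset u) p≡ q≡ ⟩
    prefix (x u) (pos (i - + 1) (j + + 1)) ℚ.- prefix aℤ ((i - + 1 + (j + + 1)) ℤ.* + n) ℚ.- offset u
      ≡⟨ sym (s≡prefix (i - + 1) (j + + 1) u) ⟩
    s (i - + 1) (j + + 1) u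
      ∎
    where
    open ≡-Reasoning
    p≡ : prefix (x u) (pos i j) ≡ prefix (x u) (pos (i - + 1) (j + + 1))
    p≡ = trans (prefix-pred-0 (x u) x≡0) (cong (prefix (x u)) (sym (pos-diag i j)))
    ring : ∀ i j n → (i + j) ℤ.* n ≡ (i - + 1 + (j + + 1)) ℤ.* n
    ring = solve-∀
    q≡ : (i + j) ℤ.* + n ≡ (i - + 1 + (j + + 1)) ℤ.* + n
    q≡ = ring i j (+ n)

  s-tight-edge : ∀ i j u → window u (pos i j) ≡ fromℕℚ k → s i j u ≡ s (i - + 1) j u
  s-tight-edge i j u tight = begin
    s i j u
      ≡⟨ s≡prefix i j u ⟩
    PX (pos i j) ℚ.- PA ((i + j) ℤ.* + n) ℚ.- offset u
      ≡⟨ cong (ℚ._- offset u) shift ⟩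
    PX (pos (i - + 1) j) ℚ.- PA ((i - + 1 + j) ℤ.* + n) ℚ.- offset u
      ≡⟨ sym (s≡prefix (i - + 1) j u) ⟩
    s (i - + 1) j u
      ∎
    where
    open ≡-Reasoning
    PX PA : ℤ → ℚ
    PX = prefix (x u)
    PA = prefix aℤ
    x-step : PX (pos i j) ℚ.- PX (pos (i - + 1) j) ≡ fromℕℚ k
    x-step = begin
      PX (pos i j) ℚ.- PX (pos (i - + 1) j)   ≡⟨ cong (λ b → PX (pos i j) ℚ.- PX b) (pos-up i j) ⟩
      PX (pos i j) ℚ.- PX (pos i j - + n)     ≡⟨ sym (window≡prefix u (pos i j)) ⟩
      window u (pos i j)                      ≡⟨ tight ⟩
      fromℕℚ k                                ∎
    ring : ∀ i j n → (i + j) ℤ.* n ≡ (i - + 1 + j) ℤ.* n + n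
    ring = solve-∀
    a-step : PA ((i + j) ℤ.* + n) ℚ.- PA ((i - + 1 + j) ℤ.* + n) ≡ fromℕℚ k
    a-step = period-sum-at ((i - + 1 + j) ℤ.* + n) (ring i j (+ n))
    shift : PX (pos i j) ℚ.- PA ((i + j) ℤ.* + n) ≡ PX (pos (i - + 1) j) ℚ.- PA ((i - + 1 + j) ℤ.* + n)
    shift = p-q≡r-s⇒p-r≡q-s (PX (pos i j)) (PX (pos (i - + 1) j)) (PA ((i + j) ℤ.* + n)) (PA ((i - + 1 + j) ℤ.* + n))
                            (trans x-step (sym a-step))

  shortWindow : V → ℤ → ℚ
  shortWindow u p = prefix (x u) (p + (+ n - + 1)) ℚ.- prefix (x u) p

  s-next-column : ∀ i j u → s i (j + + 1) u ≡ s i j u ℚ.+ shortWindow u (pos i j) ℚ.- fromℕℚ k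
  s-next-column i j u = begin
    s i (j + + 1) u
      ≡⟨ s≡prefix i (j + + 1) u ⟩
    PX (pos i (j + + 1)) ℚ.- PA ((i + (j + + 1)) ℤ.* + n) ℚ.- offset u
      ≡⟨ cong₂ (λ p q → PX p ℚ.- q ℚ.- offset u) (pos-right i j) a-step ⟩
    PX (pos i j + (+ n - + 1)) ℚ.- (PA ((i + j) ℤ.* + n) ℚ.+ fromℕℚ k) ℚ.- offset u
      ≡⟨ regroup (PX (pos i j + (+ n - + 1))) (PX (pos i j)) (PA ((i + j) ℤ.* + n)) (fromℕℚ k) (offset u) ⟩
    PX (pos i j) ℚ.- PA ((i + j) ℤ.* + n) ℚ.- offset u ℚ.+ shortWindow u (pos i j) ℚ.- fromℕℚ k
      ≡⟨ cong (λ q → q ℚ.+ shortWindow u (pos i j) ℚ.- fromℕℚ k) (sym (s≡prefix i j u)) ⟩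
    s i j u ℚ.+ shortWindow u (pos i j) ℚ.- fromℕℚ k
      ∎
    where
    open ≡-Reasoning
    PX PA : ℤ → ℚ
    PX = prefix (x u)
    PA = prefix aℤ
    ring : ∀ i j n → (i + (j + + 1)) ℤ.* n ≡ (i + j) ℤ.* n + n
    ring = solve-∀
    a-step : PA ((i + (j + + 1)) ℤ.* + n) ≡ PA ((i + j) ℤ.* + n) ℚ.+ fromℕℚ k
    a-step = p-q≡r⇒p≡q+r (period-sum-at ((i + j) ℤ.* + n) (ring i j (+ n)))
    regroup : ∀ p′ p a K o → p′ ℚ.- (a ℚ.+ K) ℚ.- o ≡ p ℚ.- a ℚ.- o ℚ.+ (p′ ℚ.- p) ℚ.- K
    regroup = solve 5 (λ p′ p a K o → p′ :- (a :+ K) :- o := p :- a :- o :+ (p′ :- p) :- K) refl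

  shortWindow-+-next : ∀ u p → shortWindow u p ℚ.+ x u (p + + n) ≡ window u (p + + n)
  shortWindow-+-next u p = begin
    PX (p + (+ n - + 1)) ℚ.- PX p ℚ.+ x u (p + + n)
      ≡⟨ cong₂ (λ b c → PX b ℚ.- PX c ℚ.+ x u (p + + n)) (ring₁ p (+ n)) (ring₂ p (+ n)) ⟩
    PX (p + + n - + 1) ℚ.- PX (p + + n - + n) ℚ.+ x u (p + + n)
      ≡⟨ regroup (PX (p + + n - + 1)) (PX (p + + n - + n)) (x u (p + + n)) ⟩
    (PX (p + + n - + 1) ℚ.+ x u (p + + n)) ℚ.- PX (p + + n - + n)
      ≡⟨ cong (ℚ._- PX (p + + n - + n)) (sym (prefix-pred (x u) (p + + n))) ⟩
    PX (p + + n) ℚ.- PX (p + + n - + n)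
      ≡⟨ sym (window≡prefix u (p + + n)) ⟩
    window u (p + + n)
      ∎
    where
    open ≡-Reasoning
    PX : ℤ → ℚ
    PX = prefix (x u)
    ring₁ : ∀ p n → p + (n - + 1) ≡ p + n - + 1
    ring₁ = solve-∀
    ring₂ : ∀ p n → p ≡ p + n - n
    ring₂ = solve-∀
    regroup : ∀ q r y → q ℚ.- r ℚ.+ y ≡ (q ℚ.+ y) ℚ.- r
    regroup = solve 3 (λ q r y → q :- r :+ y := (q :+ y) :- r) refl

-- Nonzero entries of a vertex end tight windows

module Vertex (n : ℕ) {{_ : NonZero n}} (a : Fin n → ℕ) (k>0 : 0ℚ ℚ.< fromℕℚ (Setup.k n a))
  (v : Setup.V n a) (A B : ℤ → Set) (v∈F : Setup.InF n a A B v)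
  (unique : ∀ u → Setup.InF n a A B u → Setup._≈_ n a u v) where
  open Setup n a
  open Sums n a

  private
    X : ℤ → ℚ
    X = x v
    N₀ : ℕ
    N₀ = N v
    K : ℚ
    K = fromℕℚ k

  x≥0 : ∀ i → 0ℚ ℚ.≤ X i
  x≥0 = proj₁ (proj₁ v∈F)

  window≤k : ∀ i → window v i ℚ.≤ K
  window≤k = proj₂ (proj₁ v∈F)

  zero-tight-pred : ∀ {u} → X u ≡ 0ℚ → window v u ≡ K → X (u - + n) ≡ 0ℚ × window v (u - + 1) ≡ K
  zero-tight-pred {u} x≡0 tight = x′≡0 , window′≡K
    where
    shifted : K ℚ.+ X (u - + n) ≡ window v (u - + 1) ℚ.+ 0ℚ
    shifted = subst₂ (λ w y → w ℚ.+ X (u - + n) ≡ window v (u - + 1) ℚ.+ y) tight x≡0 (window-pred v u)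
    x′≡0 : X (u - + n) ≡ 0ℚ
    x′≡0 = ℚP.≤-antisym (+-cancelˡ-≤ K (begin
      K ℚ.+ X (u - + n)           ≡⟨ shifted ⟩
      window v (u - + 1) ℚ.+ 0ℚ   ≡⟨ ℚP.+-identityʳ _ ⟩
      window v (u - + 1)          ≤⟨ window≤k (u - + 1) ⟩
      K                           ≡⟨ sym (ℚP.+-identityʳ K) ⟩
      K ℚ.+ 0ℚ                    ∎)) (x≥0 (u - + n))
      where open ℚP.≤-Reasoning
    window′≡K : window v (u - + 1) ≡ K
    window′≡K = trans (sym (ℚP.+-identityʳ _))
                  (trans (sym shifted) (trans (cong (K ℚ.+_) x′≡0) (ℚP.+-identityʳ K)))

  -- The positions whose prefix sum is pinned down by the left tail of v together
  -- with the constraints tight at v; the perturbation v′ below moves all others.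
  data Forced : ℤ → Set where
    below     : ∀ {u} → u ℤ.< - (+ N₀) → Forced u
    via-zero  : ∀ {u} → X u ≡ 0ℚ → Forced (u - + 1) → Forced u
    via-tight : ∀ {u} → window v u ≡ K → Forced (u - + n) → Forced u

  private
    ring-swap : ∀ u → u - + n - + 1 ≡ u - + 1 - + n
    ring-swap u = ring u (+ n)
      where
      ring : ∀ u n → u - n - + 1 ≡ u - + 1 - n
      ring = solve-∀

  mutual
    forced-zero-pred : ∀ {u} → Forced u → X u ≡ 0ℚ → Forced (u - + 1)
    forced-zero-pred {u} (below u<-N)      _   = below (ℤP.<-trans (i-1<i u) u<-N)
    forced-zero-pred     (via-zero _ f)    _   = f
    forced-zero-pred {u} (via-tight t f) x≡0 =
      via-tight (proj₂ (zero-tight-pred x≡0 t))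
                (subst Forced (ring-swap u) (forced-zero-pred f (proj₁ (zero-tight-pred x≡0 t))))

    forced-tight-pred : ∀ {u} → Forced u → window v u ≡ K → Forced (u - + n)
    forced-tight-pred {u} (below u<-N)    _ = below (ℤP.≤-<-trans (ℤP.i-j≤i u (+ n)) u<-N)
    forced-tight-pred     (via-tight _ f) _ = f
    forced-tight-pred {u} (via-zero x≡0 f) t =
      via-zero (proj₁ (zero-tight-pred x≡0 t))
               (subst Forced (sym (ring-swap u)) (forced-tight-pred f (proj₂ (zero-tight-pred x≡0 t))))

  forced?-below : ∀ m u → u ℤ.< - (+ N₀) + + m → Dec (Forced u)
  forced?-below zero    u u< = yes (below (subst (u ℤ.<_) (ℤP.+-identityʳ _) u<))
  forced?-below (suc m) u u< =
    map′ fold unfold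
      ((u ℤ.<? - (+ N₀))
       ⊎-dec (X u ℚP.≟ 0ℚ ×-dec forced?-below m (u - + 1) u-1<)
       ⊎-dec (window v u ℚP.≟ K ×-dec forced?-below m (u - + n) (ℤP.≤-<-trans (i-n≤i-1 u) u-1<)))
    where
    u-1< : u - + 1 ℤ.< - (+ N₀) + + m
    u-1< = ℤP.<-≤-trans (i-1<i u) (<-+suc⇒≤ (- (+ N₀)) m u<)
    fold : u ℤ.< - (+ N₀) ⊎ (X u ≡ 0ℚ × Forced (u - + 1)) ⊎ (window v u ≡ K × Forced (u - + n)) → Forced u
    fold (inj₁ u<-N)                = below u<-N
    fold (inj₂ (inj₁ (x≡0 , f)))    = via-zero x≡0 f
    fold (inj₂ (inj₂ (tight , f)))  = via-tight tight f
    unfold : Forced u → u ℤ.< - (+ N₀) ⊎ (X u ≡ 0ℚ × Forced (u - + 1)) ⊎ (window v u ≡ K × Forced (u - + n))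
    unfold (below u<-N)        = inj₁ u<-N
    unfold (via-zero x≡0 f)    = inj₂ (inj₁ (x≡0 , f))
    unfold (via-tight tight f) = inj₂ (inj₂ (tight , f))

  forced? : ∀ u → Dec (Forced u)
  forced? u = by-cases (u ℤ.<? - (+ N₀))
    where
    by-cases : Dec (u ℤ.< - (+ N₀)) → Dec (Forced u)
    by-cases (yes u<-N) = yes (below u<-N)
    by-cases (no  u≮-N) =
      let m , u≡ = ≤-offset (ℤP.≮⇒≥ u≮-N)
      in  forced?-below (suc m) u (subst (ℤ._< - (+ N₀) + + suc m) (sym u≡) (i+m<i+[1+m] (- (+ N₀)) m))

  private
    LowerBound : (ℤ → ℚ) → ℤ → ℚ → Set
    LowerBound g hi ε₀ =
      ∃ λ ε → 0ℚ ℚ.< ε × ε ℚ.≤ ε₀ × (∀ i → - (+ N₀) ℤ.≤ i → i ℤ.≤ hi → 0ℚ ℚ.< g i → ε ℚ.≤ g i)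
    x-bound : LowerBound X (+ N₀) K
    x-bound = positive-lower-bound-on X (- (+ N₀)) (+ N₀) k>0
    slack-bound : LowerBound (λ i → K ℚ.- window v i) (+ N₀ + + n) (proj₁ x-bound)
    slack-bound =
      positive-lower-bound-on (λ i → K ℚ.- window v i) (- (+ N₀)) (+ N₀ + + n) (proj₁ (proj₂ x-bound))

  ε : ℚ
  ε = proj₁ slack-bound

  ε>0 : 0ℚ ℚ.< ε
  ε>0 = proj₁ (proj₂ slack-bound)

  ε≤k : ε ℚ.≤ K
  ε≤k = ℚP.≤-trans (proj₁ (proj₂ (proj₂ slack-bound))) (proj₁ (proj₂ (proj₂ x-bound)))

  ε≤x : ∀ {i} → - (+ N₀) ℤ.≤ i → 0ℚ ℚ.< X i → ε ℚ.≤ X i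
  ε≤x {i} -N≤i x>0 = by-cases (i ℤ.≤? + N₀)
    where
    by-cases : Dec (i ℤ.≤ + N₀) → ε ℚ.≤ X i
    by-cases (yes i≤N) =
      ℚP.≤-trans (proj₁ (proj₂ (proj₂ slack-bound))) (proj₂ (proj₂ (proj₂ x-bound)) i -N≤i i≤N x>0)
    by-cases (no  i≰N) = ⊥-elim (ℚP.<-irrefl (sym (right v i (ℤP.≰⇒> i≰N))) x>0)

  window+ε≤k : ∀ {i} → - (+ N₀) ℤ.≤ i → window v i ℚ.< K → window v i ℚ.+ ε ℚ.≤ K
  window+ε≤k {i} -N≤i w<K = by-cases (i ℤ.≤? + N₀ + + n)
    where
    open ℚP.≤-Reasoning
    by-cases : Dec (i ℤ.≤ + N₀ + + n) → window v i ℚ.+ ε ℚ.≤ K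
    by-cases (yes i≤N+n) = begin
      window v i ℚ.+ ε                    ≤⟨ ℚP.+-monoʳ-≤ (window v i) (bound i -N≤i i≤N+n (p<q⇒0<q-p w<K)) ⟩
      window v i ℚ.+ (K ℚ.- window v i)   ≡⟨ p+[q-p]≡q (window v i) K ⟩
      K                                   ∎
      where bound = proj₂ (proj₂ (proj₂ slack-bound))
    by-cases (no i≰N+n) = begin
      window v i ℚ.+ ε                    ≡⟨ cong (ℚ._+ ε) (window-right-tail v i N≤i-n) ⟩
      0ℚ ℚ.+ ε                            ≡⟨ ℚP.+-identityˡ ε ⟩
      ε                                   ≤⟨ ε≤k ⟩
      K                                   ∎
      where
      ring : ∀ N n → N + n - n ≡ N
      ring = solve-∀
      N≤i-n : + N₀ ℤ.≤ i - + n
      N≤i-n = subst (ℤ._≤ i - + n) (ring (+ N₀) (+ n)) (ℤP.+-monoˡ-≤ (- (+ n)) (ℤP.<⇒≤ (ℤP.≰⇒> i≰N+n)))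

  bump : ℤ → ℚ
  bump u = if does (forced? u) then 0ℚ else ε

  bump-forced : ∀ {u} → Forced u → bump u ≡ 0ℚ
  bump-forced {u} f = cong (if_then 0ℚ else ε) (dec-true (forced? u) f)

  bump-free : ∀ {u} → ¬ Forced u → bump u ≡ ε
  bump-free {u} ¬f = cong (if_then 0ℚ else ε) (dec-false (forced? u) ¬f)

  bump-cong : ∀ {u w} → (Forced u → Forced w) → (Forced w → Forced u) → bump u ≡ bump w
  bump-cong {u} {w} f g = cong (if_then 0ℚ else ε) (does-≡ (forced? u) (map′ g f (forced? w)))

  bump-bounds : ∀ u → 0ℚ ℚ.≤ bump u × bump u ℚ.≤ ε
  bump-bounds u = by-cases (forced? u)
    where
    by-cases : (d : Dec (Forced u)) → 0ℚ ℚ.≤ (if does d then 0ℚ else ε) × (if does d then 0ℚ else ε) ℚ.≤ ε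
    by-cases (yes _) = ℚP.≤-refl , ℚP.<⇒≤ ε>0
    by-cases (no  _) = ℚP.<⇒≤ ε>0 , ℚP.≤-refl

  x′ : ℤ → ℚ
  x′ i = X i ℚ.+ (bump i ℚ.- bump (i - + 1))

  x′-flat : ∀ {i} → (Forced i → Forced (i - + 1)) → (Forced (i - + 1) → Forced i) → x′ i ≡ X i
  x′-flat {i} f g = q≡r⇒p+[q-r]≡p (X i) (bump-cong f g)

  x′-zero : ∀ {i} → X i ≡ 0ℚ → x′ i ≡ 0ℚ
  x′-zero x≡0 = trans (x′-flat (λ f → forced-zero-pred f x≡0) (via-zero x≡0)) x≡0

  v′ : V
  v′ = record
    { x     = x′
    ; N     = N₀
    ; right = λ i N<i → x′-zero (right v i N<i)
    ; left  = λ i i<-N → trans (x′-flat (λ _ → below (ℤP.<-trans (i-1<i i) i<-N)) (λ _ → below i<-N)) (left v i i<-N)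
    }

  prefix-x′ : ∀ b → prefix x′ b ≡ prefix X b ℚ.+ (bump b ℚ.- bump (+ 0))
  prefix-x′ b = sym (prefix-unique x′ (λ c → prefix X c ℚ.+ (bump c ℚ.- bump (+ 0))) F0 F-pred b)
    where
    F0 : 0ℚ ℚ.+ (bump (+ 0) ℚ.- bump (+ 0)) ≡ 0ℚ
    F0 = trans (ℚP.+-identityˡ _) (ℚP.+-inverseʳ (bump (+ 0)))
    F-pred : ∀ c → prefix X c ℚ.+ (bump c ℚ.- bump (+ 0)) ≡
                   prefix X (c - + 1) ℚ.+ (bump (c - + 1) ℚ.- bump (+ 0)) ℚ.+ x′ c
    F-pred c = trans (cong (ℚ._+ (bump c ℚ.- bump (+ 0))) (prefix-pred X c))
                     (regroup (prefix X (c - + 1)) (X c) (bump c) (bump (c - + 1)) (bump (+ 0)))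
      where
      regroup : ∀ p y b b′ b₀ → p ℚ.+ y ℚ.+ (b ℚ.- b₀) ≡ p ℚ.+ (b′ ℚ.- b₀) ℚ.+ (y ℚ.+ (b ℚ.- b′))
      regroup = solve 5 (λ p y b b′ b₀ → p :+ y :+ (b :- b₀) := p :+ (b′ :- b₀) :+ (y :+ (b :- b′))) refl

  window-v′ : ∀ i → window v′ i ≡ window v i ℚ.+ (bump i ℚ.- bump (i - + n))
  window-v′ i = begin
    window v′ i
      ≡⟨ window≡prefix v′ i ⟩
    prefix x′ i ℚ.- prefix x′ (i - + n)
      ≡⟨ cong₂ ℚ._-_ (prefix-x′ i) (prefix-x′ (i - + n)) ⟩
    (prefix X i ℚ.+ (bump i ℚ.- bump (+ 0))) ℚ.- (prefix X (i - + n) ℚ.+ (bump (i - + n) ℚ.- bump (+ 0)))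
      ≡⟨ regroup (prefix X i) (prefix X (i - + n)) (bump i) (bump (i - + n)) (bump (+ 0)) ⟩
    (prefix X i ℚ.- prefix X (i - + n)) ℚ.+ (bump i ℚ.- bump (i - + n))
      ≡⟨ cong (ℚ._+ (bump i ℚ.- bump (i - + n))) (sym (window≡prefix v i)) ⟩
    window v i ℚ.+ (bump i ℚ.- bump (i - + n))
      ∎
    where
    open ≡-Reasoning
    regroup : ∀ p q b b′ b₀ → (p ℚ.+ (b ℚ.- b₀)) ℚ.- (q ℚ.+ (b′ ℚ.- b₀)) ≡ (p ℚ.- q) ℚ.+ (b ℚ.- b′)
    regroup = solve 5 (λ p q b b′ b₀ → (p :+ (b :- b₀)) :- (q :+ (b′ :- b₀)) := (p :- q) :+ (b :- b′)) refl

  x′≥0 : ∀ i → 0ℚ ℚ.≤ x′ i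
  x′≥0 i = by-zero (X i ℚP.≟ 0ℚ)
    where
    by-zero : Dec (X i ≡ 0ℚ) → 0ℚ ℚ.≤ x′ i
    by-zero (yes x≡0) = ℚP.≤-reflexive (sym (x′-zero x≡0))
    by-zero (no  x≢0) = by-tail (i - + 1 ℤ.<? - (+ N₀))
      where
      by-tail : Dec (i - + 1 ℤ.< - (+ N₀)) → 0ℚ ℚ.≤ x′ i
      by-tail (yes i-1<-N) = subst (ℚ._≤ x′ i) (p+[q-p]≡q 0ℚ 0ℚ)
        (+-[-]-mono-≤ (x≥0 i) (proj₁ (bump-bounds i)) (ℚP.≤-reflexive (bump-forced (below i-1<-N))))
      by-tail (no  i-1≮-N) = subst (ℚ._≤ x′ i) (p+[q-p]≡q ε 0ℚ)
        (+-[-]-mono-≤ (ε≤x -N≤i (≤∧≢⇒< (x≥0 i) (x≢0 ∘ sym))) (proj₁ (bump-bounds i)) (proj₂ (bump-bounds (i - + 1))))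
        where
        -N≤i : - (+ N₀) ℤ.≤ i
        -N≤i = ℤP.<⇒≤ (ℤP.≤-<-trans (ℤP.≮⇒≥ i-1≮-N) (i-1<i i))

  window-v′-tight : ∀ i → window v i ≡ K → window v′ i ≡ K
  window-v′-tight i tight = begin
    window v′ i                                  ≡⟨ window-v′ i ⟩
    window v i ℚ.+ (bump i ℚ.- bump (i - + n))   ≡⟨ q≡r⇒p+[q-r]≡p (window v i) bumps≡ ⟩
    window v i                                   ≡⟨ tight ⟩
    K                                            ∎
    where
    open ≡-Reasoning
    bumps≡ : bump i ≡ bump (i - + n)
    bumps≡ = bump-cong {i} (λ f → forced-tight-pred f tight) (via-tight tight)

  window-v′≤k : ∀ i → window v′ i ℚ.≤ K
  window-v′≤k i = by-tight (window v i ℚP.≟ K)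
    where
    by-tight : Dec (window v i ≡ K) → window v′ i ℚ.≤ K
    by-tight (yes tight) = ℚP.≤-reflexive (window-v′-tight i tight)
    by-tight (no  slack) = begin
      window v′ i
        ≡⟨ window-v′ i ⟩
      window v i ℚ.+ (bump i ℚ.- bump (i - + n))
        ≤⟨ +-[-]-mono-≤ (ℚP.≤-refl {window v i}) (proj₂ (bump-bounds i)) (proj₁ (bump-bounds (i - + n))) ⟩
      window v i ℚ.+ (ε ℚ.- 0ℚ)
        ≡⟨ cong (window v i ℚ.+_) (ℚP.+-identityʳ ε) ⟩
      window v i ℚ.+ ε
        ≤⟨ window+ε≤k -N≤i (≤∧≢⇒< (window≤k i) slack) ⟩
      K ∎
      where
      open ℚP.≤-Reasoning
      -N≤i : - (+ N₀) ℤ.≤ i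
      -N≤i = ℤP.≮⇒≥ (λ i<-N → slack (window-left-tail v i i<-N))

  v′∈F : InF A B v′
  v′∈F = (x′≥0 , window-v′≤k) , (λ i i∈A → x′-zero (proj₁ (proj₂ v∈F) i i∈A))
                              , (λ i i∈B → window-v′-tight i (proj₂ (proj₂ v∈F) i i∈B))

  bump-constant : ∀ c → bump c ≡ bump (+ 0)
  bump-constant = ℤ-constant bump λ c → p-q≡0⇒p≡q (p+q≡p⇒q≡0 (unique v′ v′∈F c))

  nonzero⇒tight : ∀ {t} → X t ≢ 0ℚ → window v t ≡ K
  nonzero⇒tight {t} x≢0 = decidable-stable (window v t ℚP.≟ K) λ slack → ℚP.<-irrefl (sym (ε≡0 slack)) ε>0
    where
    free : window v t ≢ K → ¬ Forced t
    free slack (below t<-N)      = slack (window-left-tail v t t<-N)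
    free slack (via-zero x≡0 _)  = x≢0 x≡0
    free slack (via-tight tight _) = slack tight
    ε≡0 : window v t ≢ K → ε ≡ 0ℚ
    ε≡0 slack = begin
      ε                        ≡⟨ sym (bump-free (free slack)) ⟩
      bump t                   ≡⟨ bump-constant t ⟩
      bump (+ 0)               ≡⟨ sym (bump-constant c₀) ⟩
      bump c₀                  ≡⟨ bump-forced (below (i-1<i (- (+ N₀)))) ⟩
      0ℚ                       ∎
      where
      open ≡-Reasoning
      c₀ : ℤ
      c₀ = - (+ N₀) - + 1

-- The criterion

module Criterion (n : ℕ) {{_ : NonZero n}} (a : Fin n → ℕ) (a>0 : ∀ i → 0 < a i)
  (v : Setup.V n a) (v∈Π : Setup.InΠ n a v)
  (tight : ∀ {t} → Setup.x v t ≢ 0ℚ → Setup.window n a v t ≡ fromℕℚ (Setup.k n a)) where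
  open Setup n a
  open Sums n a

  private
    X : ℤ → ℚ
    X = x v
    N₀ : ℕ
    N₀ = N v
    K : ℚ
    K = fromℕℚ k

  x≥0 : ∀ i → 0ℚ ℚ.≤ X i
  x≥0 = proj₁ v∈Π

  Critical : ℤ → Set
  Critical l = X l ≡ 0ℚ × X (l + + n - + 1) ≢ 0ℚ

  height : ℤ × ℤ → ℚ
  height (i , j) = s i j v

  height-edge : ∀ {i j q} → Edge v (i , j) q → height (i , j) ≡ height q
  height-edge (inj₁ (refl , e)) = e
  height-edge (inj₂ (refl , e)) = e

  height-adj : ∀ {p q} → Adj v p q → height p ≡ height q
  height-adj {i , j} {i′ , j′} (inj₁ e) = height-edge {i} {j} e
  height-adj {i , j} {i′ , j′} (inj₂ e) = sym (height-edge {i′} {j′} e)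

  height-connected : ∀ {p q} → Connected v p q → height p ≡ height q
  height-connected ε★            = refl
  height-connected (p~r ◅ r~q) = trans (height-adj p~r) (height-connected r~q)

  shortWindow≤k : ∀ p → shortWindow v p ℚ.≤ K
  shortWindow≤k p = begin
    shortWindow v p                         ≡⟨ sym (ℚP.+-identityʳ _) ⟩
    shortWindow v p ℚ.+ 0ℚ                  ≤⟨ ℚP.+-monoʳ-≤ (shortWindow v p) (x≥0 (p + + n)) ⟩
    shortWindow v p ℚ.+ X (p + + n)         ≡⟨ shortWindow-+-next v p ⟩
    window v (p + + n)                      ≤⟨ proj₂ v∈Π (p + + n) ⟩
    K                                       ∎
    where open ℚP.≤-Reasoning

  s-row-step : ∀ i j → s i (j + + 1) v ℚ.≤ s i j v
  s-row-step i j = begin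
    s i (j + + 1) v                                    ≡⟨ s-next-column i j v ⟩
    s i j v ℚ.+ shortWindow v (pos i j) ℚ.- K
      ≤⟨ ℚP.+-monoˡ-≤ (ℚ.- K) (ℚP.+-monoʳ-≤ (s i j v) (shortWindow≤k (pos i j))) ⟩
    s i j v ℚ.+ K ℚ.- K                                ≡⟨ p+q-q≡p (s i j v) K ⟩
    s i j v                                            ∎
    where open ℚP.≤-Reasoning

  s-row-drop : ∀ i j → shortWindow v (pos i j) ℚ.< K → s i (j + + 1) v ℚ.< s i j v
  s-row-drop i j short<K = begin-strict
    s i (j + + 1) v                                    ≡⟨ s-next-column i j v ⟩
    s i j v ℚ.+ shortWindow v (pos i j) ℚ.- K          <⟨ ℚP.+-monoˡ-< (ℚ.- K) (ℚP.+-monoʳ-< (s i j v) short<K) ⟩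
    s i j v ℚ.+ K ℚ.- K                                ≡⟨ p+q-q≡p (s i j v) K ⟩
    s i j v                                            ∎
    where open ℚP.≤-Reasoning

  critical-lower : ∀ {l} → Critical l → - (+ N₀) ℤ.≤ l
  critical-lower {l} (x≡0 , _) =
    ℤP.≮⇒≥ λ l<-N → ℚP.<-irrefl (sym (trans (sym (left v l l<-N)) x≡0)) (aℤ-pos a>0 l)

  full-shortWindow⇒zero-at-start : ∀ {c t} → shortWindow v c ≡ K → t ℤ.≤ c + (+ n - + 1) →
                                   prefix X (c + (+ n - + 1)) ≡ prefix X t → X (t - + n + + 1) ≡ 0ℚ
  full-shortWindow⇒zero-at-start {c} {t} full t≤d Pd≡Pt = ℚP.≤-antisym x≤0 (x≥0 z)
    where
    open ℚP.≤-Reasoning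
    P : ℤ → ℚ
    P = prefix X
    z : ℤ
    z = t - + n + + 1
    Pc≤Pt-n : P c ℚ.≤ P (t - + n)
    Pc≤Pt-n = +-cancelʳ-≤ K (begin
      P c ℚ.+ K                     ≡⟨ sym (p-q≡r⇒p≡q+r full) ⟩
      P (c + (+ n - + 1))           ≡⟨ Pd≡Pt ⟩
      P t                           ≡⟨ p-q≡r⇒p≡q+r (sym (window≡prefix v t)) ⟩
      P (t - + n) ℚ.+ window v t    ≤⟨ ℚP.+-monoʳ-≤ (P (t - + n)) (proj₂ v∈Π t) ⟩
      P (t - + n) ℚ.+ K             ∎)
    ring : ∀ t n → t - n ≡ t - n + + 1 - + 1
    ring = solve-∀
    x≤0 : X z ℚ.≤ 0ℚ
    x≤0 = +-cancelˡ-≤ (P (t - + n)) (begin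
      P (t - + n) ℚ.+ X z           ≡⟨ cong (λ b → P b ℚ.+ X z) (ring t (+ n)) ⟩
      P (z - + 1) ℚ.+ X z           ≡⟨ sym (prefix-pred X z) ⟩
      P z                           ≤⟨ prefix-mono-≤ X x≥0 (window-start-≤ {c} t≤d) ⟩
      P c                           ≤⟨ Pc≤Pt-n ⟩
      P (t - + n)                   ≡⟨ sym (ℚP.+-identityʳ _) ⟩
      P (t - + n) ℚ.+ 0ℚ            ∎)

  critical-descent : ∀ {l} → Critical l → shortWindow v (l - + n) ≡ K → ∃ λ z → z ℤ.< l × Critical z
  critical-descent {l} _ full =
    let t , _ , t≤d , x-t≢0 , Pd≡Pt = last-nonzero X (i≤i+[n-1] (l - + n)) Pd≢Pc
    in  t - + n + + 1 , ℤP.≤-<-trans (window-start-≤ {l - + n} t≤d) (i-n<i l) ,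
        full-shortWindow⇒zero-at-start {l - + n} full t≤d Pd≡Pt , x-t≢0 ∘ trans (cong X (sym (ring t (+ n))))
    where
    P : ℤ → ℚ
    P = prefix X
    Pd≢Pc : P (l - + n + (+ n - + 1)) ≢ P (l - + n)
    Pd≢Pc Pd≡Pc = ℚP.<-irrefl (begin-equality
      0ℚ                                           ≡⟨ sym (ℚP.+-inverseʳ (P (l - + n))) ⟩
      P (l - + n) ℚ.- P (l - + n)                  ≡⟨ cong (ℚ._- P (l - + n)) (sym Pd≡Pc) ⟩
      P (l - + n + (+ n - + 1)) ℚ.- P (l - + n)    ≡⟨ full ⟩
      K                                            ∎) (k-pos a>0)
      where open ℚP.≤-Reasoning
    ring : ∀ t n → t - n + + 1 + n - + 1 ≡ t
    ring = solve-∀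

  Slack : ℤ → Set
  Slack l = shortWindow v (l - + n) ℚ.< K

  descend : ∀ m {l} → l ℤ.≤ - (+ N₀) + + m → Critical l → ∃ λ l′ → Critical l′ × Slack l′
  descend m {l} l≤ crit = by-slack (shortWindow v (l - + n) ℚ.<? K)
    where
    continue : ∀ m → l ℤ.≤ - (+ N₀) + + m → ∃ (λ z → z ℤ.< l × Critical z) → ∃ λ l′ → Critical l′ × Slack l′
    continue zero    l≤ (z , z<l , crit-z) = ⊥-elim (ℤP.<-irrefl refl (ℤP.<-≤-trans z<l (ℤP.≤-trans l≤-N (critical-lower crit-z))))
      where
      l≤-N : l ℤ.≤ - (+ N₀)
      l≤-N = subst (l ℤ.≤_) (ℤP.+-identityʳ _) l≤
    continue (suc m) l≤ (z , z<l , crit-z) = descend m (<-+suc⇒≤ (- (+ N₀)) m (ℤP.<-≤-trans z<l l≤)) crit-z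
    by-slack : Dec (Slack l) → ∃ λ l′ → Critical l′ × Slack l′
    by-slack (yes slack) = l , crit , slack
    by-slack (no  ¬slack) = continue m l≤ (critical-descent crit (ℚP.≤-antisym (shortWindow≤k (l - + n)) (ℚP.≮⇒≥ ¬slack)))

  critical⇒slack-critical : ∀ {l} → Critical l → ∃ λ l′ → Critical l′ × Slack l′
  critical⇒slack-critical {l} crit =
    let m , l≡ = ≤-offset (critical-lower crit)
    in  descend m (ℤP.≤-reflexive l≡) crit

  subsingleton-fewer : ∀ {P Q : ℤ → Set} {j₀ j₁ j₂} → (∀ {j} → P j → j ≡ j₀) → Q j₁ → Q j₂ → j₁ ≢ j₂ →
                       StrictlyFewer P Q
  subsingleton-fewer {P} {Q} {j₀} {j₁} {j₂} P⊆j₀ q₁ q₂ j₁≢j₂ = (to-j₁ , to-j₁-injective) , no-injection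
    where
    to-j₁ : Σ ℤ P → Σ ℤ Q
    to-j₁ _ = j₁ , q₁
    to-j₁-injective : ∀ u w → j₁ ≡ j₁ → proj₁ u ≡ proj₁ w
    to-j₁-injective (j , pj) (j′ , pj′) _ = trans (P⊆j₀ pj) (sym (P⊆j₀ pj′))
    no-injection : ¬ Injects Q P
    no-injection (f , f-injective) =
      j₁≢j₂ (f-injective (j₁ , q₁) (j₂ , q₂) (trans (P⊆j₀ (proj₂ (f (j₁ , q₁)))) (sym (P⊆j₀ (proj₂ (f (j₂ , q₂)))))))

  module Branching {l} (x≡0 : X l ≡ 0ℚ) (x≢0 : X (l + + n - + 1) ≢ 0ℚ) (slack : Slack l) where

    j₀ : ℤ
    j₀ = - l + + 1

    p : ℤ × ℤ
    p = (l - + 1 , j₀)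

    private
      ring₁ : ∀ l n → l ℤ.* n + - l ℤ.* (n - + 1) ≡ l
      ring₁ = solve-∀
      ring₂ : ∀ l n → l ℤ.* n + (- l + + 1) ℤ.* (n - + 1) ≡ l + n - + 1
      ring₂ = solve-∀
      ring₃ : ∀ l n → (l - + 1) ℤ.* n + (- l + + 1) ℤ.* (n - + 1) ≡ l - + 1
      ring₃ = solve-∀
      ring₄ : ∀ l n → (l - + 1) ℤ.* n + (- l + + 1 - + 1) ℤ.* (n - + 1) ≡ l - n
      ring₄ = solve-∀
      ring₅ : ∀ l n → l + n - + 1 ≡ l - + 1 + n
      ring₅ = solve-∀
      ring₆ : ∀ j → j - + 1 + + 1 ≡ j
      ring₆ = solve-∀

    upper-left : Connected v p (l , - l)
    upper-left = inj₂ (inj₂ (refl , s-zero-edge l (- l) v (trans (cong X (ring₁ l (+ n))) x≡0))) ◅ ε★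

    upper-right : Connected v p (l , j₀)
    upper-right = inj₂ (inj₁ (refl , s-tight-edge l j₀ v (trans (cong (window v) (ring₂ l (+ n))) (tight x≢0)))) ◅ ε★

    drop-after : s (l - + 1) (j₀ + + 1) v ℚ.< s (l - + 1) j₀ v
    drop-after = s-row-drop (l - + 1) j₀ (begin-strict
      shortWindow v (pos (l - + 1) j₀)                ≡⟨ cong (shortWindow v) (ring₃ l (+ n)) ⟩
      shortWindow v (l - + 1)                         ≡⟨ sym (ℚP.+-identityʳ _) ⟩
      shortWindow v (l - + 1) ℚ.+ 0ℚ                  <⟨ ℚP.+-monoʳ-< (shortWindow v (l - + 1)) x>0 ⟩
      shortWindow v (l - + 1) ℚ.+ X (l - + 1 + + n)   ≡⟨ shortWindow-+-next v (l - + 1) ⟩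
      window v (l - + 1 + + n)                        ≡⟨ tight (x≢0 ∘ trans (cong X (ring₅ l (+ n)))) ⟩
      K                                               ∎)
      where
      open ℚP.≤-Reasoning
      x>0 : 0ℚ ℚ.< X (l - + 1 + + n)
      x>0 = ≤∧≢⇒< (x≥0 _) (x≢0 ∘ trans (cong X (ring₅ l (+ n))) ∘ sym)

    drop-before : s (l - + 1) j₀ v ℚ.< s (l - + 1) (j₀ - + 1) v
    drop-before = subst (λ j → s (l - + 1) j v ℚ.< s (l - + 1) (j₀ - + 1) v) (ring₆ j₀)
                    (s-row-drop (l - + 1) (j₀ - + 1) slack′)
      where
      slack′ : shortWindow v (pos (l - + 1) (j₀ - + 1)) ℚ.< K
      slack′ = subst (λ b → shortWindow v b ℚ.< K) (sym (ring₄ l (+ n))) slack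

    lower-only-j₀ : ∀ {j} → RowPart v p (l - + 1) j → j ≡ j₀
    lower-only-j₀ p~j = antitone-level-unique (λ j → s (l - + 1) j v) (s-row-step (l - + 1)) drop-after drop-before
                          (sym (height-connected p~j))

    upper-fewer : StrictlyFewer (RowPart v p (l - + 1)) (RowPart v p (l - + 1 + + 1))
    upper-fewer = subsingleton-fewer lower-only-j₀ (subst (λ i → RowPart v p i (- l)) row≡ upper-left)
                    (subst (λ i → RowPart v p i j₀) row≡ upper-right) (λ e → ℤP.<-irrefl e (i<i+[1+m] (- l) 0))
      where
      row≡ : l ≡ l - + 1 + + 1
      row≡ = sym (ring₆ l)

  critical-slack⇒nonrelevant : ∀ {l} → Critical l → Slack l → NonRelevant v
  critical-slack⇒nonrelevant {l} (x≡0 , x≢0) slack = p , l - + 1 , upper-fewer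
    where open Branching x≡0 x≢0 slack

  critical⇒nonrelevant : ∃ Critical → NonRelevant v
  critical⇒nonrelevant (l , crit) =
    let l′ , crit′ , slack′ = critical⇒slack-critical crit
    in  critical-slack⇒nonrelevant crit′ slack′

  critical? : ∀ l → Dec (Critical l)
  critical? l = X l ℚP.≟ 0ℚ ×-dec ¬? (X (l + + n - + 1) ℚP.≟ 0ℚ)

  critical-upper : ∀ {l} → Critical l → l ℤ.≤ + N₀
  critical-upper {l} (_ , x≢0) = ℤP.≤-trans (subst (l ℤ.≤_) (ring l (+ n)) (i≤i+[n-1] l)) l+n-1≤N
    where
    ring : ∀ l n → l + (n - + 1) ≡ l + n - + 1
    ring = solve-∀
    l+n-1≤N : l + + n - + 1 ℤ.≤ + N₀
    l+n-1≤N = ℤP.≮⇒≥ λ N<l+n-1 → x≢0 (right v _ N<l+n-1)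

  ∃critical? : Dec (∃ Critical)
  ∃critical? = bounded-∃? critical? (- (+ N₀)) (+ N₀) (λ crit → critical-lower crit , critical-upper crit)

  zero-propagates : ¬ ∃ Critical → ∀ {q} → X q ≡ 0ℚ → X (q + (+ n - + 1)) ≡ 0ℚ
  zero-propagates no-crit {q} x≡0 =
    decidable-stable (X _ ℚP.≟ 0ℚ) λ x≢0 → no-crit (q , x≡0 , x≢0 ∘ trans (cong X (sym (ring q (+ n)))))
    where
    ring : ∀ q n → q + n - + 1 ≡ q + (n - + 1)
    ring = solve-∀

  no-critical⇒row-injection : ¬ ∃ Critical → ∀ p i → Injects (RowPart v p (i + + 1)) (RowPart v p i)
  no-critical⇒row-injection no-crit p i = step , step-injective
    where
    i₁ : ℤ
    i₁ = i + + 1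
    row≡ : i₁ - + 1 ≡ i
    row≡ = ring i
      where
      ring : ∀ i → i + + 1 - + 1 ≡ i
      ring = solve-∀
    next : ∀ j → Dec (X (pos i₁ j) ≡ 0ℚ) → ℤ
    next j (yes _) = j + + 1
    next j (no  _) = j
    next-connected : ∀ {j} → Connected v p (i₁ , j) → (d : Dec (X (pos i₁ j) ≡ 0ℚ)) → Connected v p (i , next j d)
    next-connected {j} p~j (yes x≡0) =
      subst (λ r → Connected v p (r , j + + 1)) row≡ (p~j ◅◅ (inj₁ (inj₂ (refl , s-zero-edge i₁ j v x≡0)) ◅ ε★))
    next-connected {j} p~j (no  x≢0) =
      subst (λ r → Connected v p (r , j)) row≡ (p~j ◅◅ (inj₁ (inj₁ (refl , s-tight-edge i₁ j v (tight x≢0))) ◅ ε★))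
    zero-next : ∀ j → X (pos i₁ j) ≡ 0ℚ → X (pos i₁ (j + + 1)) ≡ 0ℚ
    zero-next j x≡0 = trans (cong X (pos-right i₁ j)) (zero-propagates no-crit x≡0)
    next-injective : ∀ j j′ d d′ → next j d ≡ next j′ d′ → j ≡ j′
    next-injective j j′ (yes _)   (yes _)   e    = +-cancelʳ-≡ (+ 1) e
    next-injective j j′ (no  _)   (no  _)   e    = e
    next-injective j j′ (yes x≡0) (no  x≢0) refl = ⊥-elim (x≢0 (zero-next j x≡0))
    next-injective j j′ (no  x≢0) (yes x≡0) refl = ⊥-elim (x≢0 (zero-next j′ x≡0))
    step : Σ ℤ (RowPart v p i₁) → Σ ℤ (RowPart v p i)
    step (j , p~j) = next j (X (pos i₁ j) ℚP.≟ 0ℚ) , next-connected p~j (X (pos i₁ j) ℚP.≟ 0ℚ)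
    step-injective : ∀ u w → proj₁ (step u) ≡ proj₁ (step w) → proj₁ u ≡ proj₁ w
    step-injective (j , _) (j′ , _) = next-injective j j′ (X (pos i₁ j) ℚP.≟ 0ℚ) (X (pos i₁ j′) ℚP.≟ 0ℚ)

  nonrelevant⇒critical : NonRelevant v → ∃ Critical
  nonrelevant⇒critical (p , i , _ , no-injection) =
    decidable-stable ∃critical? (λ no-crit → no-injection (no-critical⇒row-injection no-crit p i))

proposition27 : (n : ℕ) → 2 ≤ n → {{nz : NonZero n}} → (a : Fin n → ℕ) →
    (∀ i → 0 < a i) → (v : Setup.V n a) → Setup.IsVertex n a v →
    (Setup.NonRelevant n a v ⇔
      ∃ λ (l : ℤ) → Setup.x v l ≡ 0ℚ × Setup.x v (l + + n - + 1) ≢ 0ℚ)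
proposition27 n _ a a>0 v (A , B , _ , v∈F , unique) = mk⇔ nonrelevant⇒critical critical⇒nonrelevant
  where
  open Sums n a using (k-pos)
  open Vertex n a (k-pos a>0) v A B v∈F unique using (nonzero⇒tight)
  open Criterion n a a>0 v (proj₁ v∈F) nonzero⇒tight using (nonrelevant⇒critical; critical⇒nonrelevant)
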